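{- Fix $n\in\mathbb{Z}_{\ge1}$, $k\in\mathbb{Z}_{\ge0}$, and $d\mid n$. For $j\in[1,n/d]$ let $I_d^j=[(j-1)d,jd-1]$. For a weak composition $\alpha=(\alpha_1,\dots,\alpha_{n/d})$ of $k$, let $\mathcal{S}_\alpha$ be the set of $k$-element subsets $A\subseteq[0,n-1]$ with $\#(A\cap I_d^j)=\alpha_j$ for all $j$. Let $C_d$ act on $[0,n-1]$ via the permutation $\sigma_d$ that simultaneously rotates each $I_d^j$ cyclically ($x\mapsto x+1$ within the interval, with $jd-1\mapsto(j-1)d$), and elementwise on subsets. Define $\mathrm{Sum}^*(A)=\sum_{a\in A}a-\sum_{j=1}^{n/d}\binom{\alpha_j}{2}$. Then $(\mathcal{S}_\alpha,C_d,\mathcal{S}_\alpha^{\mathrm{Sum}^*}(q))$ exhibits the cyclic sieving phenomenon.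
   Context: $[a,b]=\{i\in\mathbb{Z}:a\le i\le b\}$; $X^{\mathrm{stat}}(q)=\sum_{A\in X}q^{\mathrm{stat}(A)}$. For a finite set $W$ acted on by a cyclic group $C=\langle\tau\rangle$ of order $r$ and $f(q)\in\mathbb{N}[q]$, $(W,C,f(q))$ exhibits the CSP if $\#\{x\in W:\tau^jx=x\}=f(\omega_r^j)$ for all $j\in\mathbb{Z}$, with $\omega_r$ a fixed primitive $r$-th root of unity. -}

module Defs where

open import Level using (Level)
open import Data.Bool using (Bool; true; false; _∧_; if_then_else_)
open import Data.Nat using (ℕ; zero; suc; _+_; _*_; _∸_; _≤ᵇ_; _<ᵇ_; _≡ᵇ_)
open import Data.Nat.DivMod using (_/_; _%_)
open import Data.Nat.Combinatorics using (_C_)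
open import Data.Fin using (Fin; toℕ)
open import Data.Fin.Subset using (Subset; ∣_∣)
open import Data.List using (List; []; _∷_; _++_; map; length; filter; filterᵇ; allFin; foldr)
open import Data.Bool.ListAction using (any; all)
open import Data.Nat.ListAction using (sum)
open import Data.Vec using (Vec; lookup; tabulate; toList)
import Data.Vec as Vec
import Data.Vec.Properties as VecP
import Data.Bool.Properties as BoolP
open import Data.Product using (_×_)
open import Relation.Nullary using (¬_)
open import Algebra.Bundles using (CommutativeRing)

-- The permutation σ_d of [0,n-1] (on ℕ): rotates each block
-- I^j = [(j-1)d, jd-1] cyclically, x ↦ x+1 inside the block,
-- jd-1 ↦ (j-1)d.  (For d = 0, which never occurs since d ∣ n, n ≥ 1,
-- it is the identity.)
sigma : ℕ → ℕ → ℕ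
sigma zero    x = x
sigma (suc e) x = (x / suc e) * suc e + ((x % suc e + 1) % suc e)

allSubsets : (n : ℕ) → List (Subset n)
allSubsets zero    = Vec.[] ∷ []
allSubsets (suc n) = map (true Vec.∷_) (allSubsets n) ++ map (false Vec.∷_) (allSubsets n)

act : ∀ {n} → ℕ → Subset n → Subset n
act {n} d A = tabulate λ y → any (λ x → lookup A x ∧ (sigma d (toℕ x) ≡ᵇ toℕ y)) (allFin n)

actPow : ∀ {n} → ℕ → ℕ → Subset n → Subset n
actPow d zero    A = A
actPow d (suc j) A = act d (actPow d j A)

-- block I_d^{i+1} = [i d, (i+1) d - 1]   (0-based block index i)
inBlock : ℕ → ℕ → ℕ → Bool
inBlock d i x = ((i * d) ≤ᵇ x) ∧ (x <ᵇ (suc i * d))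

blockCount : ∀ {n} → ℕ → Subset n → ℕ → ℕ
blockCount {n} d A i = length (filterᵇ (λ x → lookup A x ∧ inBlock d i (toℕ x)) (allFin n))

Salpha : (n d m : ℕ) → Vec ℕ m → ℕ → List (Subset n)
Salpha n d m α k =
  filterᵇ (λ A → (∣ A ∣ ≡ᵇ k) ∧ all (λ i → blockCount d A (toℕ i) ≡ᵇ lookup α i) (allFin m))
          (allSubsets n)

elemSum : ∀ {n} → Subset n → ℕ
elemSum {n} A = sum (map (λ x → if lookup A x then toℕ x else 0) (allFin n))

-- Sum*(A) = Σ_{a∈A} a − Σ_j binom(α_j, 2)
-- (truncated subtraction; the true difference is always ≥ 0 on S_α)
sumStar : ∀ {n m} → Vec ℕ m → Subset n → ℕ
sumStar α A = elemSum A ∸ sum (map (λ a → a C 2) (toList α))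

fixCount : (n d m : ℕ) → Vec ℕ m → ℕ → ℕ → ℕ
fixCount n d m α k j =
  length (filter (λ A → VecP.≡-dec BoolP._≟_ (actPow d j A) A) (Salpha n d m α k))

module _ {c ℓ : Level} (R : CommutativeRing c ℓ) where
  open CommutativeRing R renaming (_*_ to _·_; _+_ to _⊕_)

  pow : Carrier → ℕ → Carrier
  pow x zero    = 1#
  pow x (suc e) = x · pow x e

  natR : ℕ → Carrier
  natR zero    = 0#
  natR (suc m) = 1# ⊕ natR m

  IsCharZeroDomain : Set (c Level.⊔ ℓ)
  IsCharZeroDomain =
    (¬ (1# ≈ 0#)) ×
    (∀ x y → x · y ≈ 0# → (x ≈ 0#) Data.Sum.⊎ (y ≈ 0#)) ×
    (∀ m → ¬ (natR (suc m) ≈ 0#))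
    where import Data.Sum

  IsPrimitiveRoot : ℕ → Carrier → Set ℓ
  IsPrimitiveRoot r ω = (pow ω r ≈ 1#) × (∀ e → 0 Data.Nat.< e → e Data.Nat.< r → ¬ (pow ω e ≈ 1#))
    where import Data.Nat

  genEval : ∀ {X : Set} → List X → (X → ℕ) → Carrier → Carrier
  genEval xs stat z = foldr (λ A acc → pow z (stat A) ⊕ acc) 0# xs

-- A subset of [0, n-1] is encoded as a bit string; for n = m·d it is a
-- concatenation of m blocks of length d.  Both sides of the CSP at q = ω^j
-- factor over the blocks: the generating function of S_α is the product of
-- the single-block generating functions Σ_{#B = a} z^(ΣB - binom(a,2)),
-- and a set is fixed by σ_d^j iff each block is fixed by the rotation by j.
-- So everything reduces to one block of size d, where, with g = gcd(d, j)
-- and o = d/g the exact order of z = ω^j: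
--  * a block is fixed by rotate^j iff by rotate^g, i.e. it is a power C^o
--    of a string C of length g (with o·#C elements);
--  * the Gaussian binomial Σ_{#B = a, B ⊆ [0, g·o-1]} z^(ΣB) equals
--    z^binom(a,2) · #{C ⊆ [0, g-1] : o·#C = a}  (q-Lucas), because
--    [o choose c]_z vanishes for 0 < c < o in an integral domain.

module Submission where

open import Defs
open import Data.Nat using (ℕ; zero; suc; _+_; _*_; _∸_; _<_; _≤_; _≤ᵇ_; _<ᵇ_; _≡ᵇ_; _≤?_; z≤n; s≤s; NonZero; ≢-nonZero; pred)
import Data.Nat.Properties as ℕₚ
open import Data.Nat.DivMod using (_/_; _%_)
import Data.Nat.DivMod as DivMod
open import Data.Nat.GeneralisedArithmetic using (fold; fold-+)
open import Data.Nat.Divisibility using (_∣_; divides; m∣m*n; ∣n⇒∣m*n; n∣m*n; *-cancelʳ-∣; ∣⇒≤; m%n≡0⇒n∣m)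
open import Data.Nat.GCD using (gcd; gcd[m,n]∣m; gcd[m,n]∣n; gcd[m,n]≢0; gcd-GCD; module Bézout)
open import Data.Nat.Coprimality using (coprime-/gcd; coprime-divisor)
open import Data.Nat.Divisibility.Core using (module _∣_)
import Data.Nat.ListAction as ℕList
open import Data.Bool using (Bool; true; false; _∧_; _∨_; if_then_else_; T)
import Data.Bool.Properties as Boolₚ
open import Data.Bool.ListAction using (any; all; and; or)
open import Data.List using (List; []; _∷_; _++_; map; length; filterᵇ; filter; allFin; initLast; _∷ʳ′_)
import Data.List.Properties as Listₚ
open import Data.Vec using (Vec; lookup; tabulate; toList; sum)
import Data.Vec as Vec
import Data.Vec.Properties as Vecₚ
open import Data.Fin using (Fin; toℕ)
import Data.Fin as Fin
open import Data.Fin.Subset using (Subset; ∣_∣)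
open import Data.Product using (_×_; _,_; proj₁; proj₂; Σ)
open import Data.Empty using (⊥-elim)
open import Data.Sum using (_⊎_; inj₁; inj₂)
open import Relation.Binary using (tri<; tri≈; tri>)
open import Function using (_∘_; id; _⇔_; mk⇔)
open import Relation.Nullary using (¬_; Dec; yes; no; does)
open import Relation.Nullary.Decidable using (does-⇔; dec-true; dec-false; _×-dec_)
open import Relation.Binary.PropositionalEquality as ≡ using (_≡_; _≢_; refl; cong; cong₂; subst; subst₂; module ≡-Reasoning)
open import Data.Nat.Tactic.RingSolver using (solve-∀)
open import Data.Nat.Combinatorics using (nC1≡n; nCk+nC[k+1]≡[n+1]C[k+1]) renaming (_C_ to _choose_)
open import Algebra.Bundles using (CommutativeRing)

-- Bit strings.  A subset A ⊆ [0, n-1] is encoded by the list of its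
-- membership bits; position i of the list stands for the element i.

Bits : Set
Bits = List Bool

ind : Bool → ℕ
ind true  = 1
ind false = 0

weight : Bits → ℕ
weight []          = 0
weight (true ∷ L)  = suc (weight L)
weight (false ∷ L) = weight L

-- Σ_{a ∈ A} a: prepending a bit shifts every element of A by one
posSum : Bits → ℕ
posSum []      = 0
posSum (b ∷ L) = posSum L + weight L

strings : ℕ → List Bits
strings zero    = [] ∷ []
strings (suc n) = map (true ∷_) (strings n) ++ map (false ∷_) (strings n)

countWhere : (ℕ → Bool) → Bits → ℕ
countWhere p []      = 0
countWhere p (b ∷ L) = ind (b ∧ p 0) + countWhere (p ∘ suc) L

sumWhere : (ℕ → ℕ) → Bits → ℕ
sumWhere f []      = 0
sumWhere f (b ∷ L) = (if b then f 0 else 0) + sumWhere (f ∘ suc) L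

anyWhere : (ℕ → Bool) → Bits → Bool
anyWhere p []      = false
anyWhere p (b ∷ L) = (b ∧ p 0) ∨ anyWhere (p ∘ suc) L

tabulateℕ : {X : Set} → ℕ → (ℕ → X) → List X
tabulateℕ zero    h = []
tabulateℕ (suc n) h = h 0 ∷ tabulateℕ n (h ∘ suc)

rotate : Bits → Bits
rotate []      = []
rotate (b ∷ L) = L ++ b ∷ []

iter : {X : Set} → (X → X) → ℕ → X → X
iter f j x = fold x f j

weight-++ : ∀ L M → weight (L ++ M) ≡ weight L + weight M
weight-++ []          M = refl
weight-++ (true ∷ L)  M = cong suc (weight-++ L M)
weight-++ (false ∷ L) M = weight-++ L M

-- the elements of M are shifted by |L| inside L ++ M
posSum-++ : ∀ L M → posSum (L ++ M) ≡ posSum L + posSum M + length L * weight M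
posSum-++ []      M = ≡.sym (ℕₚ.+-identityʳ (posSum M))
posSum-++ (b ∷ L) M = begin
    posSum (L ++ M) + weight (L ++ M)
  ≡⟨ cong₂ _+_ (posSum-++ L M) (weight-++ L M) ⟩
    posSum L + posSum M + length L * weight M + (weight L + weight M)
  ≡⟨ rearrange (posSum L) (posSum M) (weight L) (weight M) (length L) ⟩
    posSum L + weight L + posSum M + (weight M + length L * weight M)
  ∎
  where
  open ≡-Reasoning
  rearrange : ∀ s t u v l → s + t + l * v + (u + v) ≡ s + u + t + (v + l * v)
  rearrange = solve-∀

length-snoc : ∀ (L : Bits) b → length (L ++ b ∷ []) ≡ suc (length L)
length-snoc L b = ≡.trans (Listₚ.length-++ L) (ℕₚ.+-comm (length L) 1)

countWhere-++ : ∀ p L M → countWhere p (L ++ M) ≡ countWhere p L + countWhere (λ x → p (length L + x)) M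
countWhere-++ p []      M = refl
countWhere-++ p (b ∷ L) M =
  ≡.trans (cong (ind (b ∧ p 0) +_) (countWhere-++ (p ∘ suc) L M)) (≡.sym (ℕₚ.+-assoc (ind (b ∧ p 0)) _ _))

countWhere-cong : ∀ p q L → (∀ x → x < length L → p x ≡ q x) → countWhere p L ≡ countWhere q L
countWhere-cong p q []      h = refl
countWhere-cong p q (b ∷ L) h =
  cong₂ _+_ (cong (λ t → ind (b ∧ t)) (h 0 (s≤s z≤n)))
            (countWhere-cong (p ∘ suc) (q ∘ suc) L (λ x x< → h (suc x) (s≤s x<)))

countWhere-all : ∀ p L → (∀ x → x < length L → p x ≡ true) → countWhere p L ≡ weight L
countWhere-all p L h = ≡.trans (countWhere-cong p (λ _ → true) L h) (count-true L)
  where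
  count-true : ∀ L → countWhere (λ _ → true) L ≡ weight L
  count-true []          = refl
  count-true (true ∷ L)  = cong suc (count-true L)
  count-true (false ∷ L) = count-true L

countWhere-none : ∀ p L → (∀ x → x < length L → p x ≡ false) → countWhere p L ≡ 0
countWhere-none p L h = ≡.trans (countWhere-cong p (λ _ → false) L h) (count-false L)
  where
  count-false : ∀ L → countWhere (λ _ → false) L ≡ 0
  count-false []      = refl
  count-false (true ∷ L)  = count-false L
  count-false (false ∷ L) = count-false L

anyWhere-++ : ∀ p L M → anyWhere p (L ++ M) ≡ anyWhere p L ∨ anyWhere (λ x → p (length L + x)) M
anyWhere-++ p []      M = refl
anyWhere-++ p (b ∷ L) M =
  ≡.trans (cong ((b ∧ p 0) ∨_) (anyWhere-++ (p ∘ suc) L M)) (≡.sym (Boolₚ.∨-assoc (b ∧ p 0) _ _))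

anyWhere-cong : ∀ p q L → (∀ x → x < length L → p x ≡ q x) → anyWhere p L ≡ anyWhere q L
anyWhere-cong p q []      h = refl
anyWhere-cong p q (b ∷ L) h =
  cong₂ _∨_ (cong (b ∧_) (h 0 (s≤s z≤n))) (anyWhere-cong (p ∘ suc) (q ∘ suc) L (λ x x< → h (suc x) (s≤s x<)))

anyWhere-none : ∀ p L → (∀ x → x < length L → p x ≡ false) → anyWhere p L ≡ false
anyWhere-none p L h = ≡.trans (anyWhere-cong p (λ _ → false) L h) (any-false L)
  where
  any-false : ∀ L → anyWhere (λ _ → false) L ≡ false
  any-false []          = refl
  any-false (true ∷ L)  = any-false L
  any-false (false ∷ L) = any-false L

tabulateℕ-cong : ∀ {X : Set} n (h k : ℕ → X) → (∀ y → y < n → h y ≡ k y) → tabulateℕ n h ≡ tabulateℕ n k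
tabulateℕ-cong zero    h k e = refl
tabulateℕ-cong (suc n) h k e = cong₂ _∷_ (e 0 (s≤s z≤n)) (tabulateℕ-cong n (h ∘ suc) (k ∘ suc) (λ y y< → e (suc y) (s≤s y<)))

tabulateℕ-+ : ∀ {X : Set} a b (h : ℕ → X) → tabulateℕ (a + b) h ≡ tabulateℕ a h ++ tabulateℕ b (λ y → h (a + y))
tabulateℕ-+ zero    b h = refl
tabulateℕ-+ (suc a) b h = cong (h 0 ∷_) (tabulateℕ-+ a b (h ∘ suc))

length-tabulateℕ : ∀ {X : Set} n (h : ℕ → X) → length (tabulateℕ n h) ≡ n
length-tabulateℕ zero    h = refl
length-tabulateℕ (suc n) h = cong suc (length-tabulateℕ n (h ∘ suc))

anyWhere-lookup : ∀ L → tabulateℕ (length L) (λ y → anyWhere (λ x → x ≡ᵇ y) L) ≡ L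
anyWhere-lookup []      = refl
anyWhere-lookup (c ∷ L) =
  cong₂ _∷_ head (≡.trans (tabulateℕ-cong (length L) _ _ (λ y _ → tail y)) (anyWhere-lookup L))
  where
  head : (c ∧ true) ∨ anyWhere (λ x → suc x ≡ᵇ 0) L ≡ c
  head rewrite anyWhere-none (λ x → suc x ≡ᵇ 0) L (λ _ _ → refl) =
    ≡.trans (Boolₚ.∨-identityʳ _) (Boolₚ.∧-identityʳ c)
  tail : ∀ y → (c ∧ (0 ≡ᵇ suc y)) ∨ anyWhere (λ x → suc x ≡ᵇ suc y) L ≡ anyWhere (λ x → x ≡ᵇ y) L
  tail y = cong (_∨ anyWhere (λ x → x ≡ᵇ y) L) (Boolₚ.∧-zeroʳ c)

iter-+ : ∀ {X : Set} (f : X → X) a b x → iter f (a + b) x ≡ iter f a (iter f b x)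
iter-+ f a b x = fold-+ x f a

iter-suc : ∀ {X : Set} (f : X → X) j x → iter f (suc j) x ≡ iter f j (f x)
iter-suc f j x = ≡.trans (cong (λ k → iter f k x) (ℕₚ.+-comm 1 j)) (iter-+ f j 1 x)

iter-inverse : ∀ {X : Set} (P : X → Set) (f g : X → X) → (∀ x → P x → P (f x)) → (∀ x → P x → g (f x) ≡ x)
             → ∀ j x → P x → iter g j (iter f j x) ≡ x
iter-inverse P f g stable inv zero    x px = refl
iter-inverse P f g stable inv (suc j) x px =
  ≡.trans (iter-suc g j _) (≡.trans (cong (iter g j) (inv _ (iterates j))) (iter-inverse P f g stable inv j x px))
  where
  iterates : ∀ j → P (iter f j x)
  iterates zero    = px
  iterates (suc j) = stable _ (iterates j)

rotate-++ : ∀ C D → iter rotate (length C) (C ++ D) ≡ D ++ C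
rotate-++ []      D = ≡.sym (Listₚ.++-identityʳ D)
rotate-++ (c ∷ C) D = begin
    iter rotate (suc (length C)) ((c ∷ C) ++ D)
  ≡⟨ iter-suc rotate (length C) _ ⟩
    iter rotate (length C) ((C ++ D) ++ c ∷ [])
  ≡⟨ cong (iter rotate (length C)) (Listₚ.++-assoc C D (c ∷ [])) ⟩
    iter rotate (length C) (C ++ (D ++ c ∷ []))
  ≡⟨ rotate-++ C (D ++ c ∷ []) ⟩
    (D ++ c ∷ []) ++ C
  ≡⟨ Listₚ.++-assoc D (c ∷ []) C ⟩
    D ++ c ∷ C
  ∎
  where open ≡-Reasoning

rotate-period : ∀ L → iter rotate (length L) L ≡ L
rotate-period L = ≡.trans (cong (iter rotate (length L)) (≡.sym (Listₚ.++-identityʳ L))) (rotate-++ L [])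

length-rotate : ∀ L → length (rotate L) ≡ length L
length-rotate []      = refl
length-rotate (b ∷ L) = length-snoc L b

iter-fix-* : ∀ {X : Set} (f : X → X) n x → iter f n x ≡ x → ∀ q → iter f (q * n) x ≡ x
iter-fix-* f n x e zero    = refl
iter-fix-* f n x e (suc q) = ≡.trans (iter-+ f n (q * n) x) (≡.trans (cong (iter f n) (iter-fix-* f n x e q)) e)

sumWhere-cong : ∀ f g L → (∀ x → f x ≡ g x) → sumWhere f L ≡ sumWhere g L
sumWhere-cong f g []          h = refl
sumWhere-cong f g (true ∷ L)  h = cong₂ _+_ (h 0) (sumWhere-cong (f ∘ suc) (g ∘ suc) L (h ∘ suc))
sumWhere-cong f g (false ∷ L) h = sumWhere-cong (f ∘ suc) (g ∘ suc) L (h ∘ suc)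

sumWhere-shift : ∀ c L → sumWhere (c +_) L ≡ c * weight L + posSum L
sumWhere-shift c []          = ≡.sym (≡.trans (ℕₚ.+-identityʳ (c * 0)) (ℕₚ.*-zeroʳ c))
sumWhere-shift c (true ∷ L)  = begin
    (c + 0) + sumWhere (λ x → c + suc x) L
  ≡⟨ cong ((c + 0) +_) (≡.trans (sumWhere-cong _ _ L (ℕₚ.+-suc c)) (sumWhere-shift (suc c) L)) ⟩
    (c + 0) + (suc c * weight L + posSum L)
  ≡⟨ arrange c (weight L) (posSum L) ⟩
    c * suc (weight L) + (posSum L + weight L)
  ∎
  where
  open ≡-Reasoning
  arrange : ∀ c w s → (c + 0) + (suc c * w + s) ≡ c * suc w + (s + w)
  arrange = solve-∀
sumWhere-shift c (false ∷ L) = begin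
    sumWhere (λ x → c + suc x) L
  ≡⟨ ≡.trans (sumWhere-cong _ _ L (ℕₚ.+-suc c)) (sumWhere-shift (suc c) L) ⟩
    suc c * weight L + posSum L
  ≡⟨ arrange c (weight L) (posSum L) ⟩
    c * weight L + (posSum L + weight L)
  ∎
  where
  open ≡-Reasoning
  arrange : ∀ c w s → suc c * w + s ≡ c * w + (s + w)
  arrange = solve-∀

-- From subsets (Vec Bool n, Defs) to bit strings: every notion of Defs
-- is a fold over allFin n, which we unfold one element at a time.

map-allFin : ∀ {X : Set} n (Q : Fin (suc n) → X) → map Q (allFin (suc n)) ≡ Q Fin.zero ∷ map (Q ∘ Fin.suc) (allFin n)
map-allFin n Q = ≡.trans (Listₚ.map-tabulate id Q) (cong (Q Fin.zero ∷_) (≡.sym (Listₚ.map-tabulate id (Q ∘ Fin.suc))))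

length-filterᵇ : ∀ {X : Set} (Q : X → Bool) xs → length (filterᵇ Q xs) ≡ ℕList.sum (map (ind ∘ Q) xs)
length-filterᵇ Q []       = refl
length-filterᵇ Q (x ∷ xs) with Q x
... | true  = cong suc (length-filterᵇ Q xs)
... | false = length-filterᵇ Q xs

countWhere-toList : ∀ n (A : Subset n) p → length (filterᵇ (λ x → lookup A x ∧ p (toℕ x)) (allFin n)) ≡ countWhere p (toList A)
countWhere-toList n A p = ≡.trans (length-filterᵇ _ (allFin n)) (go n A p)
  where
  go : ∀ n (A : Subset n) p → ℕList.sum (map (λ x → ind (lookup A x ∧ p (toℕ x))) (allFin n)) ≡ countWhere p (toList A)
  go zero    Vec.[]       p = refl
  go (suc n) (b Vec.∷ A) p = ≡.trans (cong ℕList.sum (map-allFin n _)) (cong (ind (b ∧ p 0) +_) (go n A (p ∘ suc)))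

sumWhere-toList : ∀ n (A : Subset n) f → ℕList.sum (map (λ x → if lookup A x then f (toℕ x) else 0) (allFin n)) ≡ sumWhere f (toList A)
sumWhere-toList zero    Vec.[]       f = refl
sumWhere-toList (suc n) (b Vec.∷ A) f =
  ≡.trans (cong ℕList.sum (map-allFin n _)) (cong ((if b then f 0 else 0) +_) (sumWhere-toList n A (f ∘ suc)))

anyWhere-toList : ∀ n (A : Subset n) p → any (λ x → lookup A x ∧ p (toℕ x)) (allFin n) ≡ anyWhere p (toList A)
anyWhere-toList zero    Vec.[]       p = refl
anyWhere-toList (suc n) (b Vec.∷ A) p =
  ≡.trans (cong or (map-allFin n _)) (cong ((b ∧ p 0) ∨_) (anyWhere-toList n A (p ∘ suc)))

weight-toList : ∀ n (A : Subset n) → ∣ A ∣ ≡ weight (toList A)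
weight-toList zero    Vec.[]           = refl
weight-toList (suc n) (true Vec.∷ A)  = cong suc (weight-toList n A)
weight-toList (suc n) (false Vec.∷ A) = weight-toList n A

tabulateℕ-toList : ∀ {X : Set} n (h : ℕ → X) → toList (tabulate {n = n} (h ∘ toℕ)) ≡ tabulateℕ n h
tabulateℕ-toList zero    h = refl
tabulateℕ-toList (suc n) h = cong (h 0 ∷_) (tabulateℕ-toList n (h ∘ suc))

elemSum-posSum : ∀ n (A : Subset n) → elemSum A ≡ posSum (toList A)
elemSum-posSum n A = ≡.trans (sumWhere-toList n A id) (sumWhere-shift 0 (toList A))

strings-allSubsets : ∀ n → map toList (allSubsets n) ≡ strings n
strings-allSubsets zero    = refl
strings-allSubsets (suc n) = begin
    map toList (map (true Vec.∷_) (allSubsets n) ++ map (false Vec.∷_) (allSubsets n))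
  ≡⟨ Listₚ.map-++ toList (map (true Vec.∷_) (allSubsets n)) _ ⟩
    map toList (map (true Vec.∷_) (allSubsets n)) ++ map toList (map (false Vec.∷_) (allSubsets n))
  ≡⟨ cong₂ _++_ (prepend true) (prepend false) ⟩
    strings (suc n)
  ∎
  where
  open ≡-Reasoning
  prepend : ∀ b → map toList (map (b Vec.∷_) (allSubsets n)) ≡ map (b ∷_) (strings n)
  prepend b = ≡.trans (≡.sym (Listₚ.map-∘ (allSubsets n)))
                      (≡.trans (Listₚ.map-∘ {g = b ∷_} {f = toList} (allSubsets n)) (cong (map (b ∷_)) (strings-allSubsets n)))

≡ᵇ-cong : ∀ {x y x′ y′} → (x ≡ y → x′ ≡ y′) → (x′ ≡ y′ → x ≡ y) → (x ≡ᵇ y) ≡ (x′ ≡ᵇ y′)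
≡ᵇ-cong {x} {y} {x′} {y′} f g = does-⇔ (mk⇔ f g) (x ℕₚ.≟ y) (x′ ℕₚ.≟ y′)

≡ᵇ-false : ∀ {x y} → ¬ x ≡ y → (x ≡ᵇ y) ≡ false
≡ᵇ-false {x} {y} = dec-false (x ℕₚ.≟ y)

≡ᵇ-true : ∀ {x y} → x ≡ y → (x ≡ᵇ y) ≡ true
≡ᵇ-true {x} {y} = dec-true (x ℕₚ.≟ y)

≡ᵇ⇒≡ : ∀ x y → (x ≡ᵇ y) ≡ true → x ≡ y
≡ᵇ⇒≡ x y eq = ℕₚ.≡ᵇ⇒≡ x y (subst T (≡.sym eq) _)

≡ᵇ-+ˡ : ∀ k a b → (k + a ≡ᵇ k + b) ≡ (a ≡ᵇ b)
≡ᵇ-+ˡ zero    a b = refl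
≡ᵇ-+ˡ (suc k) a b = ≡ᵇ-+ˡ k a b

module _ (e : ℕ) where
  private
    d = suc e

  sigma-step : ∀ x → x < e → sigma d x ≡ suc x
  sigma-step x x<e = begin
      (x / d) * d + ((x % d + 1) % d)
    ≡⟨ cong₂ (λ q r → q * d + ((r + 1) % d)) (DivMod.m<n⇒m/n≡0 x<d) (DivMod.m<n⇒m%n≡m x<d) ⟩
      (x + 1) % d
    ≡⟨ DivMod.m<n⇒m%n≡m (subst (_< d) (ℕₚ.+-comm 1 x) (s≤s x<e)) ⟩
      x + 1
    ≡⟨ ℕₚ.+-comm x 1 ⟩
      suc x
    ∎
    where
    open ≡-Reasoning
    x<d = ℕₚ.m<n⇒m<1+n x<e

  sigma-wrap : sigma d e ≡ 0
  sigma-wrap = begin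
      (e / d) * d + ((e % d + 1) % d)
    ≡⟨ cong₂ (λ q r → q * d + ((r + 1) % d)) (DivMod.m<n⇒m/n≡0 e<d) (DivMod.m<n⇒m%n≡m e<d) ⟩
      (e + 1) % d
    ≡⟨ cong (_% d) (ℕₚ.+-comm e 1) ⟩
      d % d
    ≡⟨ DivMod.n%n≡0 d ⟩
      0
    ∎
    where
    open ≡-Reasoning
    e<d = ℕₚ.n<1+n e

  sigma-< : ∀ x → x < d → sigma d x < d
  sigma-< x x<d =
    subst (_< d) (≡.sym (cong (λ q → q * d + ((x % d + 1) % d)) (DivMod.m<n⇒m/n≡0 x<d))) (DivMod.m%n<n (x % d + 1) d)

  sigma-shift : ∀ x → sigma d (d + x) ≡ d + sigma d x
  sigma-shift x = begin
      ((d + x) / d) * d + (((d + x) % d + 1) % d)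
    ≡⟨ cong₂ (λ q r → q * d + ((r + 1) % d)) quot rem ⟩
      suc (x / d) * d + ((x % d + 1) % d)
    ≡⟨ ℕₚ.+-assoc d (x / d * d) _ ⟩
      d + sigma d x
    ∎
    where
    open ≡-Reasoning
    quot : (d + x) / d ≡ suc (x / d)
    quot = ≡.trans (DivMod.m/n≡1+[m∸n]/n (ℕₚ.m≤m+n d x)) (cong (λ t → suc (t / d)) (ℕₚ.m+n∸m≡n d x))
    rem : (d + x) % d ≡ x % d
    rem = ≡.trans (cong (_% d) (ℕₚ.+-comm d x)) (DivMod.[m+n]%n≡m%n x d)

actBits : ℕ → Bits → Bits
actBits d L = tabulateℕ (length L) (λ y → anyWhere (λ x → sigma d x ≡ᵇ y) L)

length-actBits : ∀ d L → length (actBits d L) ≡ length L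
length-actBits d L = length-tabulateℕ (length L) _

act-toList : ∀ d n (A : Subset n) → toList (act d A) ≡ actBits d (toList A)
act-toList d n A = begin
    toList (act d A)
  ≡⟨ cong toList (Vecₚ.tabulate-cong (λ y → anyWhere-toList n A (λ x → sigma d x ≡ᵇ toℕ y))) ⟩
    toList (tabulate (λ y → anyWhere (λ x → sigma d x ≡ᵇ toℕ y) (toList A)))
  ≡⟨ tabulateℕ-toList n (λ y → anyWhere (λ x → sigma d x ≡ᵇ y) (toList A)) ⟩
    tabulateℕ n (λ y → anyWhere (λ x → sigma d x ≡ᵇ y) (toList A))
  ≡⟨ cong (λ k → tabulateℕ k (λ y → anyWhere (λ x → sigma d x ≡ᵇ y) (toList A))) (≡.sym (Vecₚ.length-toList A)) ⟩
    actBits d (toList A)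
  ∎
  where open ≡-Reasoning

actPow-toList : ∀ d n j (A : Subset n) → toList (actPow d j A) ≡ iter (actBits d) j (toList A)
actPow-toList d n zero    A = refl
actPow-toList d n (suc j) A = ≡.trans (act-toList d n (actPow d j A)) (cong (actBits d) (actPow-toList d n j A))

module _ (e : ℕ) where
  private
    d = suc e

  actBits-++ : ∀ B C → length B ≡ d → actBits d (B ++ C) ≡ actBits d B ++ actBits d C
  actBits-++ B C lB = begin
      tabulateℕ (length (B ++ C)) hit
    ≡⟨ cong (λ k → tabulateℕ k hit) (Listₚ.length-++ B) ⟩
      tabulateℕ (length B + length C) hit
    ≡⟨ tabulateℕ-+ (length B) (length C) hit ⟩
      tabulateℕ (length B) hit ++ tabulateℕ (length C) (λ y → hit (length B + y))
    ≡⟨ cong₂ _++_ (tabulateℕ-cong (length B) _ _ inB) (tabulateℕ-cong (length C) _ _ (λ y _ → inC y)) ⟩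
      actBits d B ++ actBits d C
    ∎
    where
    open ≡-Reasoning
    hit : ℕ → Bool
    hit y = anyWhere (λ x → sigma d x ≡ᵇ y) (B ++ C)
    σC : ∀ x → sigma d (length B + x) ≡ d + sigma d x
    σC x = ≡.trans (cong (λ k → sigma d (k + x)) lB) (sigma-shift e x)
    inB : ∀ y → y < length B → hit y ≡ anyWhere (λ x → sigma d x ≡ᵇ y) B
    inB y y<B = begin
        hit y
      ≡⟨ anyWhere-++ _ B C ⟩
        anyWhere (λ x → sigma d x ≡ᵇ y) B ∨ anyWhere (λ x → sigma d (length B + x) ≡ᵇ y) C
      ≡⟨ cong (anyWhere (λ x → sigma d x ≡ᵇ y) B ∨_) (anyWhere-none _ C (λ x _ → ≡ᵇ-false (missesB x))) ⟩
        anyWhere (λ x → sigma d x ≡ᵇ y) B ∨ false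
      ≡⟨ Boolₚ.∨-identityʳ _ ⟩
        anyWhere (λ x → sigma d x ≡ᵇ y) B
      ∎
      where
      missesB : ∀ x → sigma d (length B + x) ≢ y
      missesB x eq = ℕₚ.<⇒≱ (subst (y <_) lB y<B) (subst (d ≤_) (≡.trans (≡.sym (σC x)) eq) (ℕₚ.m≤m+n d (sigma d x)))
    inC : ∀ y → hit (length B + y) ≡ anyWhere (λ x → sigma d x ≡ᵇ y) C
    inC y = begin
        hit (length B + y)
      ≡⟨ anyWhere-++ _ B C ⟩
        anyWhere (λ x → sigma d x ≡ᵇ length B + y) B ∨ anyWhere (λ x → sigma d (length B + x) ≡ᵇ length B + y) C
      ≡⟨ cong₂ _∨_ (anyWhere-none _ B (λ x x<B → ≡ᵇ-false (missesC x x<B))) (anyWhere-cong _ _ C (λ x _ → shifted x)) ⟩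
        false ∨ anyWhere (λ x → sigma d x ≡ᵇ y) C
      ∎
      where
      missesC : ∀ x → x < length B → sigma d x ≢ length B + y
      missesC x x<B eq =
        ℕₚ.<⇒≱ (sigma-< e x (subst (x <_) lB x<B)) (subst (d ≤_) (≡.sym (≡.trans eq (cong (_+ y) lB))) (ℕₚ.m≤m+n d y))
      shifted : ∀ x → (sigma d (length B + x) ≡ᵇ length B + y) ≡ (sigma d x ≡ᵇ y)
      shifted x = ≡.trans (cong₂ _≡ᵇ_ (σC x) (cong (_+ y) lB)) (≡ᵇ-+ˡ d (sigma d x) y)

  actBits-block : ∀ B b → length B ≡ e → actBits d (B ++ b ∷ []) ≡ b ∷ B
  actBits-block B b lB = begin
      tabulateℕ (length (B ++ b ∷ [])) hit
    ≡⟨ cong (λ k → tabulateℕ k hit) (≡.trans (length-snoc B b) (cong suc lB)) ⟩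
      hit 0 ∷ tabulateℕ e (hit ∘ suc)
    ≡⟨ cong₂ _∷_ first (≡.trans (tabulateℕ-cong e _ _ (λ y _ → rest y)) lookupB) ⟩
      b ∷ B
    ∎
    where
    open ≡-Reasoning
    hit : ℕ → Bool
    hit y = anyWhere (λ x → sigma d x ≡ᵇ y) (B ++ b ∷ [])
    lookupB : tabulateℕ e (λ y → anyWhere (λ x → x ≡ᵇ y) B) ≡ B
    lookupB = subst (λ k → tabulateℕ k (λ y → anyWhere (λ x → x ≡ᵇ y) B) ≡ B) lB (anyWhere-lookup B)
    inside : ∀ x → x < length B → sigma d x ≡ suc x
    inside x x<B = sigma-step e x (subst (x <_) lB x<B)
    last : sigma d (length B + 0) ≡ 0
    last = ≡.trans (cong (sigma d) (≡.trans (ℕₚ.+-identityʳ _) lB)) (sigma-wrap e)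
    first : hit 0 ≡ b
    first = begin
        hit 0
      ≡⟨ anyWhere-++ _ B (b ∷ []) ⟩
        anyWhere (λ x → sigma d x ≡ᵇ 0) B ∨ ((b ∧ (sigma d (length B + 0) ≡ᵇ 0)) ∨ false)
      ≡⟨ cong₂ (λ u v → u ∨ ((b ∧ v) ∨ false)) (anyWhere-none _ B (λ x x< → cong (_≡ᵇ 0) (inside x x<))) (cong (_≡ᵇ 0) last) ⟩
        (b ∧ true) ∨ false
      ≡⟨ ≡.trans (Boolₚ.∨-identityʳ _) (Boolₚ.∧-identityʳ b) ⟩
        b
      ∎
    rest : ∀ y → hit (suc y) ≡ anyWhere (λ x → x ≡ᵇ y) B
    rest y = begin
        hit (suc y)
      ≡⟨ anyWhere-++ _ B (b ∷ []) ⟩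
        anyWhere (λ x → sigma d x ≡ᵇ suc y) B ∨ ((b ∧ (sigma d (length B + 0) ≡ᵇ suc y)) ∨ false)
      ≡⟨ cong₂ (λ u v → u ∨ ((b ∧ v) ∨ false)) (anyWhere-cong _ _ B (λ x x< → cong (_≡ᵇ suc y) (inside x x<))) (cong (_≡ᵇ suc y) last) ⟩
        anyWhere (λ x → x ≡ᵇ y) B ∨ ((b ∧ false) ∨ false)
      ≡⟨ cong (λ v → anyWhere (λ x → x ≡ᵇ y) B ∨ (v ∨ false)) (Boolₚ.∧-zeroʳ b) ⟩
        anyWhere (λ x → x ≡ᵇ y) B ∨ false
      ≡⟨ Boolₚ.∨-identityʳ _ ⟩
        anyWhere (λ x → x ≡ᵇ y) B
      ∎

-- Fixed points of σ_d^j

_≟Bits_ : (L M : Bits) → Dec (L ≡ M)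
_≟Bits_ = Listₚ.≡-dec Boolₚ._≟_

fixedᵇ : ℕ → ℕ → Bits → Bool
fixedᵇ d j L = does (iter (actBits d) j L ≟Bits L)

++-split : ∀ (X B : Bits) {Y C} → length X ≡ length B → X ++ Y ≡ B ++ C → (X ≡ B) × (Y ≡ C)
++-split []      []      l eq = refl , eq
++-split (x ∷ X) (b ∷ B) l eq with Listₚ.∷-injective eq
... | refl , eq′ with ++-split X B (ℕₚ.suc-injective l) eq′
... | refl , r = refl , r

splitPrefix : ∀ n (L : Bits) → n ≤ length L → Σ Bits λ P → Σ Bits λ S → (L ≡ P ++ S) × (length P ≡ n)
splitPrefix zero    L       _         = [] , L , refl , refl
splitPrefix (suc n) (b ∷ L) (s≤s n≤L) with splitPrefix n L n≤L
... | P , S , refl , lP = b ∷ P , S , refl , cong suc lP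

length-iter-actBits : ∀ d j L → length (iter (actBits d) j L) ≡ length L
length-iter-actBits d zero    L = refl
length-iter-actBits d (suc j) L = ≡.trans (length-actBits d (iter (actBits d) j L)) (length-iter-actBits d j L)

module _ (e : ℕ) where
  private
    d = suc e

  iter-actBits-++ : ∀ j B C → length B ≡ d → iter (actBits d) j (B ++ C) ≡ iter (actBits d) j B ++ iter (actBits d) j C
  iter-actBits-++ zero    B C lB = refl
  iter-actBits-++ (suc j) B C lB =
    ≡.trans (cong (actBits d) (iter-actBits-++ j B C lB))
            (actBits-++ e (iter (actBits d) j B) _ (≡.trans (length-iter-actBits d j B) lB))

  fixedᵇ-++ : ∀ j B C → length B ≡ d → fixedᵇ d j (B ++ C) ≡ fixedᵇ d j B ∧ fixedᵇ d j C
  fixedᵇ-++ j B C lB = does-⇔ (mk⇔ split join) (iter f j (B ++ C) ≟Bits (B ++ C)) (iter f j B ≟Bits B ×-dec iter f j C ≟Bits C)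
    where
    f = actBits d
    split : iter f j (B ++ C) ≡ B ++ C → (iter f j B ≡ B) × (iter f j C ≡ C)
    split eq = ++-split _ B (length-iter-actBits d j B) (≡.trans (≡.sym (iter-actBits-++ j B C lB)) eq)
    join : (iter f j B ≡ B) × (iter f j C ≡ C) → iter f j (B ++ C) ≡ B ++ C
    join (p , q) = ≡.trans (iter-actBits-++ j B C lB) (cong₂ _++_ p q)

  actBits-rotate : ∀ L → length L ≡ d → actBits d (rotate L) ≡ L
  actBits-rotate (b ∷ L) l = actBits-block e L b (ℕₚ.suc-injective l)

  rotate-actBits : ∀ L → length L ≡ d → rotate (actBits d L) ≡ L
  rotate-actBits L l with initLast L
  ... | B ∷ʳ′ b = cong rotate (actBits-block e B b (ℕₚ.suc-injective (≡.trans (≡.sym (length-snoc B b)) l)))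

  fixedᵇ-rotate : ∀ j L → length L ≡ d → fixedᵇ d j L ≡ does (iter rotate j L ≟Bits L)
  fixedᵇ-rotate j L l = does-⇔ (mk⇔ to from) (iter (actBits d) j L ≟Bits L) (iter rotate j L ≟Bits L)
    where
    Block : Bits → Set
    Block M = length M ≡ d
    to : iter (actBits d) j L ≡ L → iter rotate j L ≡ L
    to eq = ≡.trans (cong (iter rotate j) (≡.sym eq))
                    (iter-inverse Block (actBits d) rotate (λ M p → ≡.trans (length-actBits d M) p) rotate-actBits j L l)
    from : iter rotate j L ≡ L → iter (actBits d) j L ≡ L
    from eq = ≡.trans (cong (iter (actBits d) j) (≡.sym eq))
                      (iter-inverse Block rotate (actBits d) (λ M p → ≡.trans (length-rotate M) p) actBits-rotate j L l)

repeat : ℕ → Bits → Bits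
repeat zero    C = []
repeat (suc k) C = C ++ repeat k C

length-repeat : ∀ k C → length (repeat k C) ≡ k * length C
length-repeat zero    C = refl
length-repeat (suc k) C = ≡.trans (Listₚ.length-++ C) (cong (length C +_) (length-repeat k C))

weight-repeat : ∀ k C → weight (repeat k C) ≡ k * weight C
weight-repeat zero    C = refl
weight-repeat (suc k) C = ≡.trans (weight-++ C (repeat k C)) (cong (weight C +_) (weight-repeat k C))

repeat-comm : ∀ k C → repeat k C ++ C ≡ C ++ repeat k C
repeat-comm zero    C = ≡.sym (Listₚ.++-identityʳ C)
repeat-comm (suc k) C = ≡.trans (Listₚ.++-assoc C (repeat k C) C) (cong (C ++_) (repeat-comm k C))

commuting⇒repeat : ∀ k C D → length D ≡ k * length C → D ++ C ≡ C ++ D → D ≡ repeat k C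
commuting⇒repeat zero    C []  l eq = refl
commuting⇒repeat (suc k) C D l eq with splitPrefix (length C) D (subst (length C ≤_) (≡.sym l) (ℕₚ.m≤m+n (length C) (k * length C)))
... | D₁ , D₂ , refl , l₁ = cong₂ _++_ D₁≡C (commuting⇒repeat k C D₂ l₂ (≡.trans (proj₂ halves) (cong (_++ D₂) D₁≡C)))
  where
  halves : (D₁ ≡ C) × (D₂ ++ C ≡ D₁ ++ D₂)
  halves = ++-split D₁ C l₁ (≡.trans (≡.sym (Listₚ.++-assoc D₁ D₂ C)) eq)
  D₁≡C = proj₁ halves
  l₂ : length D₂ ≡ k * length C
  l₂ = ℕₚ.+-cancelˡ-≡ (length C) _ _ (≡.trans (cong (_+ length D₂) (≡.sym l₁)) (≡.trans (≡.sym (Listₚ.length-++ D₁)) l))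

rotate-fixed⇔repeat : ∀ k C D → length D ≡ k * length C → (iter rotate (length C) (C ++ D) ≡ C ++ D) ⇔ (D ≡ repeat k C)
rotate-fixed⇔repeat k C D lD = mk⇔
  (λ fixed → commuting⇒repeat k C D lD (≡.trans (≡.sym (rotate-++ C D)) fixed))
  (λ { refl → ≡.trans (rotate-++ C (repeat k C)) (repeat-comm k C) })

-- Finite sums in a commutative ring

module Sums {c ℓ} (R : CommutativeRing c ℓ) where
  open CommutativeRing R renaming (_+_ to _⊕_; _*_ to _⊗_; refl to ≈-refl; sym to ≈-sym; trans to ≈-trans)
  open import Algebra.Properties.CommutativeSemigroup +-commutativeSemigroup using (interchange)
  open import Relation.Binary.Reasoning.Setoid setoid

  [_]·_ : Bool → Carrier → Carrier
  [ true  ]· x = x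
  [ false ]· x = 0#

  ∑ : {X : Set} → (X → Carrier) → List X → Carrier
  ∑ f []       = 0#
  ∑ f (x ∷ xs) = f x ⊕ ∑ f xs

  ∑-++ : ∀ {X : Set} (f : X → Carrier) xs ys → ∑ f (xs ++ ys) ≈ ∑ f xs ⊕ ∑ f ys
  ∑-++ f []       ys = ≈-sym (+-identityˡ _)
  ∑-++ f (x ∷ xs) ys = ≈-trans (+-congˡ (∑-++ f xs ys)) (≈-sym (+-assoc _ _ _))

  ∑-map : ∀ {X Y : Set} (f : Y → Carrier) (g : X → Y) xs → ∑ f (map g xs) ≡ ∑ (f ∘ g) xs
  ∑-map f g []       = refl
  ∑-map f g (x ∷ xs) = cong (f (g x) ⊕_) (∑-map f g xs)

  ∑-cong : ∀ {X : Set} {f g : X → Carrier} xs → (∀ x → f x ≈ g x) → ∑ f xs ≈ ∑ g xs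
  ∑-cong []       h = ≈-refl
  ∑-cong (x ∷ xs) h = +-cong (h x) (∑-cong xs h)

  ∑-zero : ∀ {X : Set} (xs : List X) → ∑ (λ _ → 0#) xs ≈ 0#
  ∑-zero []       = ≈-refl
  ∑-zero (x ∷ xs) = ≈-trans (+-congˡ (∑-zero xs)) (+-identityʳ _)

  ∑-+ : ∀ {X : Set} (f g : X → Carrier) xs → ∑ (λ x → f x ⊕ g x) xs ≈ ∑ f xs ⊕ ∑ g xs
  ∑-+ f g []       = ≈-sym (+-identityʳ _)
  ∑-+ f g (x ∷ xs) = ≈-trans (+-congˡ (∑-+ f g xs)) (interchange _ _ _ _)

  ∑-*ˡ : ∀ {X : Set} k (f : X → Carrier) xs → k ⊗ ∑ f xs ≈ ∑ (λ x → k ⊗ f x) xs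
  ∑-*ˡ k f []       = zeroʳ k
  ∑-*ˡ k f (x ∷ xs) = ≈-trans (distribˡ k _ _) (+-congˡ (∑-*ˡ k f xs))

  ∑-*ʳ : ∀ {X : Set} k (f : X → Carrier) xs → ∑ f xs ⊗ k ≈ ∑ (λ x → f x ⊗ k) xs
  ∑-*ʳ k f xs = ≈-trans (*-comm _ _) (≈-trans (∑-*ˡ k f xs) (∑-cong xs (λ x → *-comm _ _)))

  ∑-swap : ∀ {X Y : Set} (f : X → Y → Carrier) xs ys → ∑ (λ x → ∑ (f x) ys) xs ≈ ∑ (λ y → ∑ (λ x → f x y) xs) ys
  ∑-swap f []       ys = ≈-sym (∑-zero ys)
  ∑-swap f (x ∷ xs) ys = ≈-trans (+-congˡ (∑-swap f xs ys)) (≈-sym (∑-+ (f x) _ ys))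

  ∑-product : ∀ {X Y : Set} (f : X → Carrier) (g : Y → Carrier) xs ys → ∑ (λ x → ∑ (λ y → f x ⊗ g y) ys) xs ≈ ∑ f xs ⊗ ∑ g ys
  ∑-product f g xs ys = ≈-trans (∑-cong xs (λ x → ≈-sym (∑-*ˡ (f x) g ys))) (≈-sym (∑-*ʳ (∑ g ys) f xs))

  ∑-strings-suc : ∀ n (f : Bits → Carrier) → ∑ f (strings (suc n)) ≈ ∑ (λ L → f (true ∷ L)) (strings n) ⊕ ∑ (λ L → f (false ∷ L)) (strings n)
  ∑-strings-suc n f = ≈-trans (∑-++ f (map (true ∷_) (strings n)) _) (reflexive (cong₂ _⊕_ (∑-map f _ (strings n)) (∑-map f _ (strings n))))

  ∑-strings-cong : ∀ n {f g : Bits → Carrier} → (∀ L → length L ≡ n → f L ≈ g L) → ∑ f (strings n) ≈ ∑ g (strings n)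
  ∑-strings-cong zero    h = +-congʳ (h [] refl)
  ∑-strings-cong (suc n) {f} {g} h =
    ≈-trans (∑-strings-suc n f)
      (≈-trans (+-cong (∑-strings-cong n (λ L l → h (true ∷ L) (cong suc l))) (∑-strings-cong n (λ L l → h (false ∷ L) (cong suc l))))
               (≈-sym (∑-strings-suc n g)))

  ∑-strings-split : ∀ a b (f : Bits → Carrier) → ∑ f (strings (a + b)) ≈ ∑ (λ C → ∑ (λ D → f (C ++ D)) (strings b)) (strings a)
  ∑-strings-split zero    b f = ≈-sym (+-identityʳ _)
  ∑-strings-split (suc a) b f =
    ≈-trans (∑-strings-suc (a + b) f) (≈-trans (+-cong (∑-strings-split a b _) (∑-strings-split a b _)) (≈-sym (∑-strings-suc a _)))

  ∑-none : ∀ {X : Set} (xs : List X) (P : X → Bool) → ∑ (λ x → [ P x ∧ false ]· 1#) xs ≈ 0#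
  ∑-none xs P = ≈-trans (∑-cong xs (λ x → reflexive (cong ([_]· 1#) (Boolₚ.∧-zeroʳ (P x))))) (∑-zero xs)

  ∑-strings-single : ∀ (P : Bits → Bool) E → ∑ (λ D → [ P D ∧ does (D ≟Bits E) ]· 1#) (strings (length E)) ≈ [ P E ]· 1#
  ∑-strings-single P []          with P []
  ... | true  = +-identityʳ _
  ... | false = +-identityʳ _
  ∑-strings-single P (true ∷ E)  = begin
      ∑ (λ D → [ P D ∧ does (D ≟Bits (true ∷ E)) ]· 1#) (strings (suc (length E)))
    ≈⟨ ∑-strings-suc (length E) _ ⟩
      ∑ (λ D → [ P (true ∷ D) ∧ does (D ≟Bits E) ]· 1#) (strings (length E)) ⊕ ∑ (λ D → [ P (false ∷ D) ∧ false ]· 1#) (strings (length E))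
    ≈⟨ +-cong (∑-strings-single (λ D → P (true ∷ D)) E) (∑-none (strings (length E)) (λ D → P (false ∷ D))) ⟩
      [ P (true ∷ E) ]· 1# ⊕ 0#
    ≈⟨ +-identityʳ _ ⟩
      [ P (true ∷ E) ]· 1#
    ∎
  ∑-strings-single P (false ∷ E) = begin
      ∑ (λ D → [ P D ∧ does (D ≟Bits (false ∷ E)) ]· 1#) (strings (suc (length E)))
    ≈⟨ ∑-strings-suc (length E) _ ⟩
      ∑ (λ D → [ P (true ∷ D) ∧ false ]· 1#) (strings (length E)) ⊕ ∑ (λ D → [ P (false ∷ D) ∧ does (D ≟Bits E) ]· 1#) (strings (length E))
    ≈⟨ +-cong (∑-none (strings (length E)) (λ D → P (true ∷ D))) (∑-strings-single (λ D → P (false ∷ D)) E) ⟩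
      0# ⊕ [ P (false ∷ E) ]· 1#
    ≈⟨ +-identityˡ _ ⟩
      [ P (false ∷ E) ]· 1#
    ∎

  [_]·-cong : ∀ b {x y} → (b ≡ true → x ≈ y) → [ b ]· x ≈ [ b ]· y
  [ true  ]·-cong h = h refl
  [ false ]·-cong h = ≈-refl

  [_]·-*ʳ : ∀ b x y → [ b ]· (x ⊗ y) ≈ ([ b ]· x) ⊗ y
  [ true  ]·-*ʳ x y = ≈-refl
  [ false ]·-*ʳ x y = ≈-sym (zeroˡ y)

  [_]·-*ˡ : ∀ b x y → [ b ]· (x ⊗ y) ≈ x ⊗ ([ b ]· y)
  [ true  ]·-*ˡ x y = ≈-refl
  [ false ]·-*ˡ x y = ≈-sym (zeroʳ x)

  [∧]·-* : ∀ b b′ x y → [ b ∧ b′ ]· (x ⊗ y) ≈ ([ b ]· x) ⊗ ([ b′ ]· y)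
  [∧]·-* true  b′ x y = [ b′ ]·-*ˡ x y
  [∧]·-* false b′ x y = ≈-sym (zeroˡ _)

  [_]·-false : ∀ b {x} → b ≡ false → [ b ]· x ≈ 0#
  [ .false ]·-false refl = ≈-refl

  [≡ᵇ]·-subst : ∀ p b (f : ℕ → Carrier) → [ p ≡ᵇ b ]· f p ≈ [ p ≡ᵇ b ]· f b
  [≡ᵇ]·-subst p b f = [ p ≡ᵇ b ]·-cong (λ h → reflexive (cong f (≡ᵇ⇒≡ p b h)))

  pow-+ : ∀ x a b → pow R x (a + b) ≈ pow R x a ⊗ pow R x b
  pow-+ x zero    b = ≈-sym (*-identityˡ _)
  pow-+ x (suc a) b = ≈-trans (*-congˡ (pow-+ x a b)) (≈-sym (*-assoc _ _ _))

  pow-cong : ∀ {x y} a → x ≈ y → pow R x a ≈ pow R y a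
  pow-cong zero    p = ≈-refl
  pow-cong (suc a) p = *-cong p (pow-cong a p)

  pow-* : ∀ x a b → pow R x (a * b) ≈ pow R (pow R x b) a
  pow-* x zero    b = ≈-refl
  pow-* x (suc a) b = ≈-trans (pow-+ x b (a * b)) (*-congˡ (pow-* x a b))

  pow-1# : ∀ a → pow R 1# a ≈ 1#
  pow-1# zero    = ≈-refl
  pow-1# (suc a) = ≈-trans (*-identityˡ _) (pow-1# a)

  cancel-unit : ∀ {x y} u v → u ⊗ v ≈ 1# → x ⊗ u ≈ y ⊗ u → x ≈ y
  cancel-unit {x} {y} u v uv≈1 xu≈yu = begin
      x               ≈⟨ ≈-sym (≈-trans (*-congˡ uv≈1) (*-identityʳ x)) ⟩
      x ⊗ (u ⊗ v)     ≈⟨ ≈-sym (*-assoc x u v) ⟩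
      (x ⊗ u) ⊗ v     ≈⟨ *-congʳ xu≈yu ⟩
      (y ⊗ u) ⊗ v     ≈⟨ *-assoc y u v ⟩
      y ⊗ (u ⊗ v)     ≈⟨ ≈-trans (*-congˡ uv≈1) (*-identityʳ y) ⟩
      y               ∎

  genEval-filterᵇ : ∀ {X : Set} (P : X → Bool) (s : X → ℕ) z xs → genEval R (filterᵇ P xs) s z ≈ ∑ (λ A → [ P A ]· pow R z (s A)) xs
  genEval-filterᵇ P s z []       = ≈-refl
  genEval-filterᵇ P s z (x ∷ xs) with P x
  ... | true  = +-congˡ (genEval-filterᵇ P s z xs)
  ... | false = ≈-trans (genEval-filterᵇ P s z xs) (≈-sym (+-identityˡ _))

  natR-count : ∀ {X : Set} (P : X → Bool) (Q : X → Set) (Q? : ∀ x → Dec (Q x)) xs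
             → natR R (length (filter Q? (filterᵇ P xs))) ≈ ∑ (λ A → [ P A ∧ does (Q? A) ]· 1#) xs
  natR-count P Q Q? []       = ≈-refl
  natR-count P Q Q? (x ∷ xs) with P x
  ... | false = ≈-trans (natR-count P Q Q? xs) (≈-sym (+-identityˡ _))
  ... | true with does (Q? x)
  ...   | true  = +-congˡ (natR-count P Q Q? xs)
  ...   | false = ≈-trans (natR-count P Q Q? xs) (≈-sym (+-identityˡ _))

module Counting {c ℓ} (R : CommutativeRing c ℓ) where
  open CommutativeRing R renaming (_+_ to _⊕_; _*_ to _⊗_; refl to ≈-refl; sym to ≈-sym; trans to ≈-trans)
  open Sums R
  open import Relation.Binary.Reasoning.Setoid setoid

  scaledCount : ℕ → ℕ → ℕ → Carrier
  scaledCount o h a = ∑ (λ C → [ o * weight C ≡ᵇ a ]· 1#) (strings h)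

  -- a string of length h + 1 either starts with a one (adding o to o·#C) or not
  scaledCount-suc : ∀ o h a → o ≤ a → scaledCount o (suc h) a ≈ scaledCount o h (a ∸ o) ⊕ scaledCount o h a
  scaledCount-suc o h a o≤a = ≈-trans (∑-strings-suc h _) (+-congʳ (∑-cong (strings h) (λ C → reflexive (cong ([_]· 1#)
    (≡ᵇ-cong (λ k → ≡.trans (≡.sym (ℕₚ.m+n∸m≡n o (o * weight C))) (cong (_∸ o) (≡.trans (≡.sym (ℕₚ.*-suc o (weight C))) k)))
             (λ k → ≡.trans (ℕₚ.*-suc o (weight C)) (≡.trans (cong (o +_) k) (ℕₚ.m+[n∸m]≡n o≤a))))))))

  scaledCount-suc-< : ∀ o h a → a < o → scaledCount o (suc h) a ≈ scaledCount o h a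
  scaledCount-suc-< o h a a<o = ≈-trans (∑-strings-suc h _) (≈-trans (+-congʳ (≈-trans (∑-cong (strings h) too-big) (∑-zero (strings h)))) (+-identityˡ _))
    where
    too-big : ∀ C → [ o * suc (weight C) ≡ᵇ a ]· 1# ≈ 0#
    too-big C = [ _ ]·-false (≡ᵇ-false (λ k → ℕₚ.<⇒≱ a<o (subst (o ≤_) (≡.trans (≡.sym (ℕₚ.*-suc o (weight C))) k) (ℕₚ.m≤m+n o (o * weight C)))))

  -- the strings of length (k+1)·g fixed by rotate^g are the powers C^(k+1),
  -- whose weight is (k+1)·#C
  periodic-count : ∀ g k a → ∑ (λ L → [ (weight L ≡ᵇ a) ∧ does (iter rotate g L ≟Bits L) ]· 1#) (strings (g + k * g))
                           ≈ scaledCount (suc k) g a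
  periodic-count g k a = begin
      ∑ (λ L → [ (weight L ≡ᵇ a) ∧ does (iter rotate g L ≟Bits L) ]· 1#) (strings (g + k * g))
    ≈⟨ ∑-strings-split g (k * g) _ ⟩
      ∑ (λ C → ∑ (λ D → [ (weight (C ++ D) ≡ᵇ a) ∧ does (iter rotate g (C ++ D) ≟Bits (C ++ D)) ]· 1#) (strings (k * g))) (strings g)
    ≈⟨ ∑-strings-cong g (λ { C refl → powers C }) ⟩
      scaledCount (suc k) g a
    ∎
    where
    powers : ∀ C → ∑ (λ D → [ (weight (C ++ D) ≡ᵇ a) ∧ does (iter rotate (length C) (C ++ D) ≟Bits (C ++ D)) ]· 1#) (strings (k * length C))
                   ≈ [ suc k * weight C ≡ᵇ a ]· 1#
    powers C = begin
        ∑ (λ D → [ (weight (C ++ D) ≡ᵇ a) ∧ does (iter rotate (length C) (C ++ D) ≟Bits (C ++ D)) ]· 1#) (strings (k * length C))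
      ≈⟨ ∑-strings-cong (k * length C) (λ D lD → reflexive (cong ([_]· 1#) (cong₂ _∧_ (cong (_≡ᵇ a) (weight-++ C D))
           (does-⇔ (rotate-fixed⇔repeat k C D lD) (iter rotate (length C) (C ++ D) ≟Bits (C ++ D)) (D ≟Bits repeat k C))))) ⟩
        ∑ (λ D → [ (weight C + weight D ≡ᵇ a) ∧ does (D ≟Bits repeat k C) ]· 1#) (strings (k * length C))
      ≡⟨ cong (λ n → ∑ (λ D → [ (weight C + weight D ≡ᵇ a) ∧ does (D ≟Bits repeat k C) ]· 1#) (strings n)) (≡.sym (length-repeat k C)) ⟩
        ∑ (λ D → [ (weight C + weight D ≡ᵇ a) ∧ does (D ≟Bits repeat k C) ]· 1#) (strings (length (repeat k C)))
      ≈⟨ ∑-strings-single (λ D → weight C + weight D ≡ᵇ a) (repeat k C) ⟩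
        [ weight C + weight (repeat k C) ≡ᵇ a ]· 1#
      ≡⟨ cong (λ t → [ weight C + t ≡ᵇ a ]· 1#) (weight-repeat k C) ⟩
        [ suc k * weight C ≡ᵇ a ]· 1#
      ∎

-- Triangular numbers binom(b, 2), the least possible Σ A for #A = b

triangle : ℕ → ℕ
triangle zero    = 0
triangle (suc n) = triangle n + n

triangle-choose : ∀ a → a choose 2 ≡ triangle a
triangle-choose zero    = refl
triangle-choose (suc a) =
  ≡.trans (≡.sym (nCk+nC[k+1]≡[n+1]C[k+1] a 1)) (≡.trans (cong₂ _+_ (nC1≡n a) (triangle-choose a)) (ℕₚ.+-comm a (triangle a)))

triangle-+ : ∀ x y → triangle (x + y) ≡ triangle x + triangle y + x * y
triangle-+ x zero    = begin
    triangle (x + 0)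
  ≡⟨ cong triangle (ℕₚ.+-identityʳ x) ⟩
    triangle x
  ≡⟨ arrange (triangle x) x ⟩
    triangle x + 0 + x * 0
  ∎
  where
  open ≡-Reasoning
  arrange : ∀ t x → t ≡ t + 0 + x * 0
  arrange = solve-∀
triangle-+ x (suc y) = begin
    triangle (x + suc y)
  ≡⟨ cong triangle (ℕₚ.+-suc x y) ⟩
    triangle (x + y) + (x + y)
  ≡⟨ cong (_+ (x + y)) (triangle-+ x y) ⟩
    triangle x + triangle y + x * y + (x + y)
  ≡⟨ arrange (triangle x) (triangle y) x y ⟩
    triangle x + (triangle y + y) + x * suc y
  ∎
  where
  open ≡-Reasoning
  arrange : ∀ s t x y → s + t + x * y + (x + y) ≡ s + (t + y) + x * (1 + y)
  arrange = solve-∀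

triangle-≤-posSum : ∀ L → triangle (weight L) ≤ posSum L
triangle-≤-posSum []          = z≤n
triangle-≤-posSum (true ∷ L)  = ℕₚ.+-monoˡ-≤ (weight L) (triangle-≤-posSum L)
triangle-≤-posSum (false ∷ L) = ℕₚ.≤-trans (triangle-≤-posSum L) (ℕₚ.m≤m+n (posSum L) (weight L))

-- Gaussian binomials as subset generating functions:
-- qBinom n b = Σ_{A ⊆ [0,n-1], #A = b} z^(Σ A) = z^binom(b,2) [n choose b]_z.

module QBinomial {c ℓ} (R : CommutativeRing c ℓ) (z : CommutativeRing.Carrier R) where
  open CommutativeRing R renaming (_+_ to _⊕_; _*_ to _⊗_; refl to ≈-refl; sym to ≈-sym; trans to ≈-trans)
  open Sums R
  open import Relation.Binary.Reasoning.Setoid setoid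

  z^ : ℕ → Carrier
  z^ = pow R z

  qBinom : ℕ → ℕ → Carrier
  qBinom n b = ∑ (λ L → [ weight L ≡ᵇ b ]· z^ (posSum L)) (strings n)

  -- prepending a bit shifts all elements: the factor z^b
  shift-term : ∀ L b → [ weight L ≡ᵇ b ]· z^ (posSum L + weight L) ≈ z^ b ⊗ ([ weight L ≡ᵇ b ]· z^ (posSum L))
  shift-term L b = ≈-trans ([≡ᵇ]·-subst (weight L) b (λ w → z^ (posSum L + w)))
                   (≈-trans ([ weight L ≡ᵇ b ]·-cong (λ _ → ≈-trans (pow-+ z (posSum L) b) (*-comm _ _))) ([ weight L ≡ᵇ b ]·-*ˡ (z^ b) _))

  pascal-first : ∀ n b → qBinom (suc n) (suc b) ≈ z^ b ⊗ qBinom n b ⊕ z^ (suc b) ⊗ qBinom n (suc b)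
  pascal-first n b = ≈-trans (∑-strings-suc n _)
    (+-cong (≈-trans (∑-cong (strings n) (λ L → shift-term L b)) (≈-sym (∑-*ˡ _ _ (strings n))))
            (≈-trans (∑-cong (strings n) (λ L → shift-term L (suc b))) (≈-sym (∑-*ˡ _ _ (strings n)))))

  qBinom-zero : ∀ n → qBinom n 0 ≈ 1#
  qBinom-zero zero    = +-identityʳ _
  qBinom-zero (suc n) = begin
      qBinom (suc n) 0
    ≈⟨ ∑-strings-suc n _ ⟩
      ∑ (λ L → 0#) (strings n) ⊕ ∑ (λ L → [ weight L ≡ᵇ 0 ]· z^ (posSum L + weight L)) (strings n)
    ≈⟨ +-cong (∑-zero (strings n)) (∑-cong (strings n) (λ L → ≈-trans (shift-term L 0) (*-identityˡ _))) ⟩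
      0# ⊕ qBinom n 0
    ≈⟨ ≈-trans (+-identityˡ _) (qBinom-zero n) ⟩
      1#
    ∎

  pascal-last : ∀ n b → qBinom (suc n) (suc b) ≈ z^ n ⊗ qBinom n b ⊕ qBinom n (suc b)
  pascal-last n b = begin
      qBinom (suc n) (suc b)
    ≡⟨ cong (λ k → ∑ f (strings k)) (ℕₚ.+-comm 1 n) ⟩
      ∑ f (strings (n + 1))
    ≈⟨ ∑-strings-split n 1 f ⟩
      ∑ (λ E → f (E ++ true ∷ []) ⊕ (f (E ++ false ∷ []) ⊕ 0#)) (strings n)
    ≈⟨ ∑-strings-cong n (λ E lE → +-cong (with-last E lE) (≈-trans (+-identityʳ _) (without-last E))) ⟩
      ∑ (λ E → z^ n ⊗ ([ weight E ≡ᵇ b ]· z^ (posSum E)) ⊕ [ weight E ≡ᵇ suc b ]· z^ (posSum E)) (strings n)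
    ≈⟨ ∑-+ _ _ (strings n) ⟩
      ∑ (λ E → z^ n ⊗ ([ weight E ≡ᵇ b ]· z^ (posSum E))) (strings n) ⊕ qBinom n (suc b)
    ≈⟨ +-congʳ (≈-sym (∑-*ˡ _ _ (strings n))) ⟩
      z^ n ⊗ qBinom n b ⊕ qBinom n (suc b)
    ∎
    where
    f : Bits → Carrier
    f L = [ weight L ≡ᵇ suc b ]· z^ (posSum L)
    with-last : ∀ E → length E ≡ n → f (E ++ true ∷ []) ≈ z^ n ⊗ ([ weight E ≡ᵇ b ]· z^ (posSum E))
    with-last E lE = begin
        f (E ++ true ∷ [])
      ≡⟨ cong₂ (λ w s → [ w ≡ᵇ suc b ]· z^ s) (≡.trans (weight-++ E _) (ℕₚ.+-comm (weight E) 1))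
               (≡.trans (posSum-++ E _) (cong₂ _+_ (ℕₚ.+-identityʳ (posSum E)) (≡.trans (ℕₚ.*-identityʳ _) lE))) ⟩
        [ weight E ≡ᵇ b ]· z^ (posSum E + n)
      ≈⟨ [ weight E ≡ᵇ b ]·-cong (λ _ → ≈-trans (pow-+ z (posSum E) n) (*-comm _ _)) ⟩
        [ weight E ≡ᵇ b ]· (z^ n ⊗ z^ (posSum E))
      ≈⟨ [ weight E ≡ᵇ b ]·-*ˡ (z^ n) _ ⟩
        z^ n ⊗ ([ weight E ≡ᵇ b ]· z^ (posSum E))
      ∎
    without-last : ∀ E → f (E ++ false ∷ []) ≈ [ weight E ≡ᵇ suc b ]· z^ (posSum E)
    without-last E = reflexive (cong₂ (λ w s → [ w ≡ᵇ suc b ]· z^ s) (≡.trans (weight-++ E _) (ℕₚ.+-identityʳ (weight E)))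
                       (≡.trans (posSum-++ E _) (≡.trans (cong₂ _+_ (ℕₚ.+-identityʳ (posSum E)) (ℕₚ.*-zeroʳ (length E))) (ℕₚ.+-identityʳ (posSum E)))))

  qBinom-shift : ∀ n p a → p ≤ a → ∑ (λ L → [ weight L + p ≡ᵇ a ]· z^ (posSum L)) (strings n) ≈ qBinom n (a ∸ p)
  qBinom-shift n p a p≤a = ∑-cong (strings n) (λ L → reflexive (cong (λ t → [ t ]· z^ (posSum L))
    (≡ᵇ-cong (λ h → ≡.trans (≡.sym (ℕₚ.m+n∸n≡m (weight L) p)) (cong (_∸ p) h)) (λ h → ≡.trans (cong (_+ p) h) (ℕₚ.m∸n+n≡m p≤a)))))

  qBinom-shift-none : ∀ n p a → ¬ p ≤ a → ∑ (λ L → [ weight L + p ≡ᵇ a ]· z^ (posSum L)) (strings n) ≈ 0#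
  qBinom-shift-none n p a p≰a = ≈-trans (∑-cong (strings n) (λ L → [ _ ]·-false (≡ᵇ-false (λ h → p≰a (subst (p ≤_) h (ℕₚ.m≤n+m p (weight L)))))))
                                        (∑-zero (strings n))

  qBinom-big : ∀ n b → n < b → qBinom n b ≈ 0#
  qBinom-big zero    (suc b) _         = +-identityʳ _
  qBinom-big (suc n) (suc b) (s≤s n<b) = begin
      qBinom (suc n) (suc b)
    ≈⟨ pascal-first n b ⟩
      z^ b ⊗ qBinom n b ⊕ z^ (suc b) ⊗ qBinom n (suc b)
    ≈⟨ +-cong (*-congˡ (qBinom-big n b n<b)) (*-congˡ (qBinom-big n (suc b) (ℕₚ.m<n⇒m<1+n n<b))) ⟩
      z^ b ⊗ 0# ⊕ z^ (suc b) ⊗ 0#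
    ≈⟨ ≈-trans (+-cong (zeroʳ _) (zeroʳ _)) (+-identityʳ _) ⟩
      0#
    ∎

  qBinom-top : ∀ n → qBinom n n ≈ z^ (triangle n)
  qBinom-top zero    = +-identityʳ _
  qBinom-top (suc n) = begin
      qBinom (suc n) (suc n)
    ≈⟨ pascal-first n n ⟩
      z^ n ⊗ qBinom n n ⊕ z^ (suc n) ⊗ qBinom n (suc n)
    ≈⟨ +-cong (*-congˡ (qBinom-top n)) (≈-trans (*-congˡ (qBinom-big n (suc n) (ℕₚ.n<1+n n))) (zeroʳ _)) ⟩
      z^ n ⊗ z^ (triangle n) ⊕ 0#
    ≈⟨ ≈-trans (+-identityʳ _) (*-comm _ _) ⟩
      z^ (triangle n) ⊗ z^ n
    ≈⟨ ≈-sym (pow-+ z (triangle n) n) ⟩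
      z^ (triangle (suc n))
    ∎

-- Evaluation at a root of unity of exact order o in an integral
-- domain (q-Lucas): qBinom (h·o) a = z^binom(a,2) · #{C ∈ 2^[h] : o·#C = a}.

module QLucas {c ℓ} (R : CommutativeRing c ℓ) where
  open CommutativeRing R renaming (_+_ to _⊕_; _*_ to _⊗_; refl to ≈-refl; sym to ≈-sym; trans to ≈-trans)
  open Sums R

  open Counting R

  module AtRoot (noZeroDivisors : ∀ x y → x ⊗ y ≈ 0# → x ≈ 0# ⊎ y ≈ 0#)
                (z : Carrier) (o′ : ℕ) (z^o : pow R z (suc o′) ≈ 1#)
                (z^b≉1 : ∀ b → 0 < b → b < suc o′ → ¬ pow R z b ≈ 1#) where
    open QBinomial R z
    open import Relation.Binary.Reasoning.Setoid setoid
    open import Algebra.Properties.Ring ring using (-1*x≈-x; x∙y⁻¹≈ε⇒x≈y; +-cancelˡ)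

    private
      o = suc o′

    fixed-by-scalar : ∀ x G → x ⊗ G ≈ G → ¬ x ≈ 1# → G ≈ 0#
    fixed-by-scalar x G xG≈G x≉1 with noZeroDivisors (x ⊕ - 1#) G (begin
        (x ⊕ - 1#) ⊗ G   ≈⟨ distribʳ G x (- 1#) ⟩
        x ⊗ G ⊕ - 1# ⊗ G ≈⟨ +-cong xG≈G (-1*x≈-x G) ⟩
        G ⊕ - G          ≈⟨ -‿inverseʳ G ⟩
        0#               ∎)
    ... | inj₁ x-1≈0 = ⊥-elim (x≉1 (x∙y⁻¹≈ε⇒x≈y x 1# x-1≈0))
    ... | inj₂ G≈0   = G≈0

    -- for 0 ≤ b < o the two Pascal rules and z^o = 1 give z^b·qBinom o b = qBinom o b
    qBinom-invariant : ∀ b → b < o → z^ b ⊗ qBinom o b ≈ qBinom o b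
    qBinom-invariant zero    _     = *-identityˡ _
    qBinom-invariant (suc b) sb<o = +-cancelˡ (qBinom o b) _ _ (begin
        qBinom o b ⊕ z^ (suc b) ⊗ qBinom o (suc b)
      ≈⟨ +-congʳ (≈-sym (qBinom-invariant b (ℕₚ.<-trans (ℕₚ.n<1+n b) sb<o))) ⟩
        z^ b ⊗ qBinom o b ⊕ z^ (suc b) ⊗ qBinom o (suc b)
      ≈⟨ ≈-trans (≈-sym (pascal-first o b)) (pascal-last o b) ⟩
        z^ o ⊗ qBinom o b ⊕ qBinom o (suc b)
      ≈⟨ +-congʳ (≈-trans (*-congʳ z^o) (*-identityˡ _)) ⟩
        qBinom o b ⊕ qBinom o (suc b)
      ∎)

    Z : Carrier
    Z = z^ (triangle o)

    qBinom-order : ∀ c → qBinom o c ≈ [ c ≡ᵇ 0 ]· 1# ⊕ [ c ≡ᵇ o ]· Z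
    qBinom-order zero = ≈-trans (qBinom-zero o) (≈-sym (+-identityʳ _))
    qBinom-order (suc c) with ℕₚ.<-cmp (suc c) o
    ... | tri< c<o _ _ = ≈-trans (fixed-by-scalar (z^ (suc c)) _ (qBinom-invariant (suc c) c<o) (z^b≉1 (suc c) (s≤s z≤n) c<o))
                                 (≈-sym (≈-trans (+-congˡ ([ _ ]·-false (≡ᵇ-false (ℕₚ.<⇒≢ c<o)))) (+-identityʳ _)))
    ... | tri≈ _ refl _ = ≈-trans (qBinom-top o) (≈-sym (≈-trans (+-identityˡ _) (reflexive (cong ([_]· Z) (≡ᵇ-true {o} refl)))))
    ... | tri> _ _ c>o = ≈-trans (qBinom-big o (suc c) c>o)
                                 (≈-sym (≈-trans (+-congˡ ([ _ ]·-false (≡ᵇ-false (ℕₚ.>⇒≢ c>o)))) (+-identityʳ _)))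

    -- the generating function of one block of length o, with p further elements
    first-block : ∀ p a → ∑ (λ E → [ weight E + p ≡ᵇ a ]· z^ (posSum E)) (strings o) ≈ [ p ≡ᵇ a ]· 1# ⊕ [ p + o ≡ᵇ a ]· Z
    first-block p a with p ≤? a
    ... | yes p≤a = begin
        ∑ (λ E → [ weight E + p ≡ᵇ a ]· z^ (posSum E)) (strings o)
      ≈⟨ qBinom-shift o p a p≤a ⟩
        qBinom o (a ∸ p)
      ≈⟨ qBinom-order (a ∸ p) ⟩
        [ a ∸ p ≡ᵇ 0 ]· 1# ⊕ [ a ∸ p ≡ᵇ o ]· Z
      ≡⟨ cong₂ (λ u v → [ u ]· 1# ⊕ [ v ]· Z)
           (≡ᵇ-cong (λ h → ≡.sym (≡.trans (≡.sym (ℕₚ.m∸n+n≡m p≤a)) (cong (_+ p) h))) (λ h → ≡.trans (cong (a ∸_) h) (ℕₚ.n∸n≡0 a)))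
           (≡ᵇ-cong (λ h → ≡.trans (cong (p +_) (≡.sym h)) (ℕₚ.m+[n∸m]≡n p≤a)) (λ h → ≡.trans (cong (_∸ p) (≡.sym h)) (ℕₚ.m+n∸m≡n p o))) ⟩
        [ p ≡ᵇ a ]· 1# ⊕ [ p + o ≡ᵇ a ]· Z
      ∎
    ... | no p≰a = begin
        ∑ (λ E → [ weight E + p ≡ᵇ a ]· z^ (posSum E)) (strings o)
      ≈⟨ qBinom-shift-none o p a p≰a ⟩
        0#
      ≈⟨ ≈-sym (≈-trans (+-cong ([ _ ]·-false (≡ᵇ-false (λ h → p≰a (subst (p ≤_) h ℕₚ.≤-refl))))
                                ([ _ ]·-false (≡ᵇ-false (λ h → p≰a (subst (p ≤_) h (ℕₚ.m≤m+n p o))))))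
                        (+-identityʳ 0#)) ⟩
        [ p ≡ᵇ a ]· 1# ⊕ [ p + o ≡ᵇ a ]· Z
      ∎

    z^o* : ∀ k → z^ (o * k) ≈ 1#
    z^o* k = ≈-trans (reflexive (cong z^ (ℕₚ.*-comm o k))) (≈-trans (pow-* z k o) (≈-trans (pow-cong k z^o) (pow-1# k)))

    -- a first block E of length o shifts the rest by o, which z does not see
    block-term : ∀ a E L → length E ≡ o
               → [ weight (E ++ L) ≡ᵇ a ]· z^ (posSum (E ++ L)) ≈ [ weight E + weight L ≡ᵇ a ]· (z^ (posSum E) ⊗ z^ (posSum L))
    block-term a E L lE = begin
        [ weight (E ++ L) ≡ᵇ a ]· z^ (posSum (E ++ L))
      ≡⟨ cong₂ (λ w s → [ w ≡ᵇ a ]· z^ s) (weight-++ E L) (≡.trans (posSum-++ E L) (cong (λ t → posSum E + posSum L + t * weight L) lE)) ⟩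
        [ weight E + weight L ≡ᵇ a ]· z^ (posSum E + posSum L + o * weight L)
      ≈⟨ [ weight E + weight L ≡ᵇ a ]·-cong (λ _ → drop-shift) ⟩
        [ weight E + weight L ≡ᵇ a ]· (z^ (posSum E) ⊗ z^ (posSum L))
      ∎
      where
      drop-shift : z^ (posSum E + posSum L + o * weight L) ≈ z^ (posSum E) ⊗ z^ (posSum L)
      drop-shift = ≈-trans (pow-+ z (posSum E + posSum L) (o * weight L))
                           (≈-trans (*-cong (pow-+ z (posSum E) (posSum L)) (z^o* (weight L))) (*-identityʳ _))

    -- the elements of a subset of [0, o + m - 1] lying beyond the first block
    beyond : ℕ → ℕ → Carrier
    beyond m a = ∑ (λ L → [ weight L + o ≡ᵇ a ]· z^ (posSum L)) (strings m)

    -- splitting off the first block: it is either empty or full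
    qBinom-add-block : ∀ m a → qBinom (o + m) a ≈ qBinom m a ⊕ Z ⊗ beyond m a
    qBinom-add-block m a = begin
        qBinom (o + m) a
      ≈⟨ ∑-strings-split o m _ ⟩
        ∑ (λ E → ∑ (λ L → [ weight (E ++ L) ≡ᵇ a ]· z^ (posSum (E ++ L))) (strings m)) (strings o)
      ≈⟨ ∑-strings-cong o (λ E lE → ∑-cong (strings m) (λ L → block-term a E L lE)) ⟩
        ∑ (λ E → ∑ (λ L → [ weight E + weight L ≡ᵇ a ]· (z^ (posSum E) ⊗ z^ (posSum L))) (strings m)) (strings o)
      ≈⟨ ∑-swap _ (strings o) (strings m) ⟩
        ∑ (λ L → ∑ (λ E → [ weight E + weight L ≡ᵇ a ]· (z^ (posSum E) ⊗ z^ (posSum L))) (strings o)) (strings m)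
      ≈⟨ ∑-cong (strings m) (λ L → ≈-trans (∑-cong (strings o) (λ E → [ weight E + weight L ≡ᵇ a ]·-*ʳ _ _)) (≈-sym (∑-*ʳ _ _ (strings o)))) ⟩
        ∑ (λ L → ∑ (λ E → [ weight E + weight L ≡ᵇ a ]· z^ (posSum E)) (strings o) ⊗ z^ (posSum L)) (strings m)
      ≈⟨ ∑-cong (strings m) (λ L → ≈-trans (*-congʳ (first-block (weight L) a)) (split-term L)) ⟩
        ∑ (λ L → [ weight L ≡ᵇ a ]· z^ (posSum L) ⊕ Z ⊗ ([ weight L + o ≡ᵇ a ]· z^ (posSum L))) (strings m)
      ≈⟨ ≈-trans (∑-+ _ _ (strings m)) (+-congˡ (≈-sym (∑-*ˡ Z _ (strings m)))) ⟩
        qBinom m a ⊕ Z ⊗ beyond m a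
      ∎
      where
      split-term : ∀ L → ([ weight L ≡ᵇ a ]· 1# ⊕ [ weight L + o ≡ᵇ a ]· Z) ⊗ z^ (posSum L)
                       ≈ [ weight L ≡ᵇ a ]· z^ (posSum L) ⊕ Z ⊗ ([ weight L + o ≡ᵇ a ]· z^ (posSum L))
      split-term L = ≈-trans (distribʳ _ _ _) (+-cong
        (≈-trans (≈-sym ([ weight L ≡ᵇ a ]·-*ʳ 1# _)) ([ weight L ≡ᵇ a ]·-cong (λ _ → *-identityˡ _)))
        (≈-trans (≈-sym ([ weight L + o ≡ᵇ a ]·-*ʳ Z _)) ([ weight L + o ≡ᵇ a ]·-*ˡ Z _)))

    -- z^binom(a,2) = Z · z^binom(a-o,2), as z^(o(a-o)) = 1
    triangle-split : ∀ a → o ≤ a → z^ (triangle a) ≈ Z ⊗ z^ (triangle (a ∸ o))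
    triangle-split a o≤a = begin
        z^ (triangle a)
      ≡⟨ cong z^ (≡.trans (cong triangle (≡.sym (ℕₚ.m+[n∸m]≡n o≤a))) (triangle-+ o (a ∸ o))) ⟩
        z^ (triangle o + triangle (a ∸ o) + o * (a ∸ o))
      ≈⟨ pow-+ z (triangle o + triangle (a ∸ o)) (o * (a ∸ o)) ⟩
        z^ (triangle o + triangle (a ∸ o)) ⊗ z^ (o * (a ∸ o))
      ≈⟨ ≈-trans (*-cong (pow-+ z (triangle o) (triangle (a ∸ o))) (z^o* (a ∸ o))) (*-identityʳ _) ⟩
        Z ⊗ z^ (triangle (a ∸ o))
      ∎

    q-lucas : ∀ h a → qBinom (h * o) a ≈ z^ (triangle a) ⊗ scaledCount o h a
    q-lucas zero    zero    = ≈-sym (≈-trans (*-identityˡ _) (reflexive (cong (λ t → [ t ≡ᵇ 0 ]· 1# ⊕ 0#) (ℕₚ.*-zeroʳ o))))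
    q-lucas zero    (suc a) = ≈-trans (+-identityʳ 0#) (≈-sym (≈-trans (*-congˡ (reflexive (cong (λ t → [ t ≡ᵇ suc a ]· 1# ⊕ 0#) (ℕₚ.*-zeroʳ o))))
                                             (≈-trans (*-congˡ (+-identityʳ 0#)) (zeroʳ _))))
    q-lucas (suc h) a with o ≤? a
    ... | yes o≤a = begin
        qBinom (o + h * o) a
      ≈⟨ qBinom-add-block (h * o) a ⟩
        qBinom (h * o) a ⊕ Z ⊗ beyond (h * o) a
      ≈⟨ +-cong (q-lucas h a) (*-congˡ (≈-trans (qBinom-shift (h * o) o a o≤a) (q-lucas h (a ∸ o)))) ⟩
        z^ (triangle a) ⊗ scaledCount o h a ⊕ Z ⊗ (z^ (triangle (a ∸ o)) ⊗ scaledCount o h (a ∸ o))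
      ≈⟨ +-congˡ (≈-trans (≈-sym (*-assoc _ _ _)) (*-congʳ (≈-sym (triangle-split a o≤a)))) ⟩
        z^ (triangle a) ⊗ scaledCount o h a ⊕ z^ (triangle a) ⊗ scaledCount o h (a ∸ o)
      ≈⟨ ≈-trans (+-comm _ _) (≈-sym (distribˡ _ _ _)) ⟩
        z^ (triangle a) ⊗ (scaledCount o h (a ∸ o) ⊕ scaledCount o h a)
      ≈⟨ *-congˡ (≈-sym (scaledCount-suc o h a o≤a)) ⟩
        z^ (triangle a) ⊗ scaledCount o (suc h) a
      ∎
    ... | no o≰a = begin
        qBinom (o + h * o) a
      ≈⟨ qBinom-add-block (h * o) a ⟩
        qBinom (h * o) a ⊕ Z ⊗ beyond (h * o) a
      ≈⟨ +-cong (q-lucas h a) (≈-trans (*-congˡ (qBinom-shift-none (h * o) o a o≰a)) (zeroʳ Z)) ⟩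
        z^ (triangle a) ⊗ scaledCount o h a ⊕ 0#
      ≈⟨ ≈-trans (+-identityʳ _) (*-congˡ (≈-sym (scaledCount-suc-< o h a (ℕₚ.≰⇒> o≰a)))) ⟩
        z^ (triangle a) ⊗ scaledCount o (suc h) a
      ∎

-- The order of j modulo d.  With g = gcd(d, j) and d = o·g:
-- f^j and f^g have the same fixed points among those of f^d, and
-- d ∣ j·b iff o ∣ b, so ω^j has exact order o for ω of order d.

module RotationOrder (e j : ℕ) where
  d : ℕ
  d = suc e

  g : ℕ
  g = gcd d j

  instance
    g-nonZero : NonZero g
    g-nonZero = ≢-nonZero (gcd[m,n]≢0 d j (inj₁ (λ ())))

  o : ℕ
  o = d / g

  d≡o*g : d ≡ o * g
  d≡o*g = ≡.sym (DivMod.m/n*n≡m (gcd[m,n]∣m d j))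

  j≡j/g*g : j ≡ (j / g) * g
  j≡j/g*g = ≡.sym (DivMod.m/n*n≡m (gcd[m,n]∣n d j))

  o′ : ℕ
  o′ = pred o

  o≡1+o′ : o ≡ suc o′
  o≡1+o′ with o | d≡o*g
  ... | suc _ | _ = refl

  d≡1+o′*g : d ≡ suc o′ * g
  d≡1+o′*g = ≡.trans d≡o*g (cong (_* g) o≡1+o′)

  fixed-j⇔fixed-g : ∀ {X : Set} (f : X → X) x → iter f d x ≡ x → (iter f j x ≡ x) ⇔ (iter f g x ≡ x)
  fixed-j⇔fixed-g f x fixed-d = mk⇔ to (λ fixed-g → ≡.trans (cong (λ t → iter f t x) j≡j/g*g) (iter-fix-* f g x fixed-g (j / g)))
    where
    open ≡-Reasoning
    -- by Bézout, g = a·d - b·j or g = b·j - a·d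
    to : iter f j x ≡ x → iter f g x ≡ x
    to fixed-j with Bézout.identity (gcd-GCD d j)
    ... | Bézout.+- a b eq = begin
        iter f g x                        ≡⟨ cong (iter f g) (≡.sym (iter-fix-* f j x fixed-j b)) ⟩
        iter f g (iter f (b * j) x)       ≡⟨ ≡.sym (iter-+ f g (b * j) x) ⟩
        iter f (g + b * j) x              ≡⟨ cong (λ t → iter f t x) eq ⟩
        iter f (a * d) x                  ≡⟨ iter-fix-* f d x fixed-d a ⟩
        x                                 ∎
    ... | Bézout.-+ a b eq = begin
        iter f g x                        ≡⟨ cong (iter f g) (≡.sym (iter-fix-* f d x fixed-d a)) ⟩
        iter f g (iter f (a * d) x)       ≡⟨ ≡.sym (iter-+ f g (a * d) x) ⟩
        iter f (g + a * d) x              ≡⟨ cong (λ t → iter f t x) eq ⟩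
        iter f (b * j) x                  ≡⟨ iter-fix-* f j x fixed-j b ⟩
        x                                 ∎

  d∣j*o : d ∣ j * o
  d∣j*o = divides (j / g) (begin
      j * o                 ≡⟨ cong (_* o) j≡j/g*g ⟩
      (j / g) * g * o       ≡⟨ ℕₚ.*-assoc (j / g) g o ⟩
      (j / g) * (g * o)     ≡⟨ cong ((j / g) *_) (≡.trans (ℕₚ.*-comm g o) (≡.sym d≡o*g)) ⟩
      (j / g) * d           ∎)
    where open ≡-Reasoning

  -- o = d / g and j / g are coprime
  d∣j*b⇒o∣b : ∀ b → d ∣ j * b → o ∣ b
  d∣j*b⇒o∣b b d∣jb = coprime-divisor (coprime-/gcd d j) (*-cancelʳ-∣ g (subst₂ _∣_ d≡o*g j*b≡ d∣jb))
    where
    j*b≡ : j * b ≡ (j / g) * b * g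
    j*b≡ = ≡.trans (cong (_* b) j≡j/g*g) (arrange (j / g) g b)
      where
      arrange : ∀ x y z → x * y * z ≡ x * z * y
      arrange = solve-∀

∧-true : ∀ {a b} → a ∧ b ≡ true → (a ≡ true) × (b ≡ true)
∧-true {true} {true} _ = refl , refl

∧-interchange : ∀ a b c d → (a ∧ b) ∧ (c ∧ d) ≡ (a ∧ c) ∧ (b ∧ d)
∧-interchange true  b true  d = refl
∧-interchange true  b false d = Boolₚ.∧-zeroʳ b
∧-interchange false b c d = refl

all-cong : ∀ {X : Set} (f g : X → Bool) xs → (∀ x → f x ≡ g x) → all f xs ≡ all g xs
all-cong f g []       h = refl
all-cong f g (x ∷ xs) h = cong₂ _∧_ (h x) (all-cong f g xs h)

∸-+-distrib : ∀ x y w t s → t ≤ x → s ≤ y → x + y + w ∸ (t + s) ≡ (x ∸ t) + (y ∸ s) + w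
∸-+-distrib x y w t s t≤x s≤y = ≡.trans (cong (_∸ (t + s)) split) (ℕₚ.m+n∸n≡m _ (t + s))
  where
  arrange : ∀ a b w t s → a + t + (b + s) + w ≡ a + b + w + (t + s)
  arrange = solve-∀
  split : x + y + w ≡ (x ∸ t) + (y ∸ s) + w + (t + s)
  split = ≡.trans (cong₂ (λ u v → u + v + w) (≡.sym (ℕₚ.m∸n+n≡m t≤x)) (≡.sym (ℕₚ.m∸n+n≡m s≤y))) (arrange (x ∸ t) (y ∸ s) w t s)

module Blocks (e : ℕ) where
  d : ℕ
  d = suc e

  blocksMatch : ∀ {m} → Vec ℕ m → Bits → Bool
  blocksMatch {m} α L = all (λ i → countWhere (inBlock d (toℕ i)) L ≡ᵇ lookup α i) (allFin m)

  admissible : ∀ {m} → Vec ℕ m → Bits → Bool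
  admissible α L = (weight L ≡ᵇ sum α) ∧ blocksMatch α L

  minSum : ∀ {m} → Vec ℕ m → ℕ
  minSum α = ℕList.sum (map (_choose 2) (toList α))

  private
    ≤ᵇ-+ˡ : ∀ k a b → (k + a ≤ᵇ k + b) ≡ (a ≤ᵇ b)
    ≤ᵇ-+ˡ k a b = does-⇔ (mk⇔ (ℕₚ.+-cancelˡ-≤ k a b) (ℕₚ.+-monoʳ-≤ k)) (k + a ≤? k + b) (a ≤? b)

    <ᵇ-+ˡ : ∀ k a b → (k + a <ᵇ k + b) ≡ (a <ᵇ b)
    <ᵇ-+ˡ zero    a b = refl
    <ᵇ-+ˡ (suc k) a b = <ᵇ-+ˡ k a b

  inBlock-first : ∀ x → x < d → inBlock d 0 x ≡ true
  inBlock-first x x<d = dec-true (x ℕₚ.<? 1 * d) (subst (x <_) (≡.sym (ℕₚ.*-identityˡ d)) x<d)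

  inBlock-first-beyond : ∀ x → inBlock d 0 (d + x) ≡ false
  inBlock-first-beyond x = dec-false (d + x ℕₚ.<? 1 * d) (λ lt → ℕₚ.<⇒≱ lt (subst (_≤ d + x) (≡.sym (ℕₚ.*-identityˡ d)) (ℕₚ.m≤m+n d x)))

  inBlock-later : ∀ i x → x < d → inBlock d (suc i) x ≡ false
  inBlock-later i x x<d = cong (_∧ (x <ᵇ suc (suc i) * d))
    (dec-false (d + i * d ≤? x) (λ le → ℕₚ.<⇒≱ x<d (ℕₚ.≤-trans (ℕₚ.m≤m+n d (i * d)) le)))

  inBlock-shift : ∀ i x → inBlock d (suc i) (d + x) ≡ inBlock d i x
  inBlock-shift i x = cong₂ _∧_ (≤ᵇ-+ˡ d (i * d) x) (<ᵇ-+ˡ d x (d + i * d))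

  blocksMatch-++ : ∀ {m} a (α : Vec ℕ m) B M → length B ≡ d → blocksMatch (a Vec.∷ α) (B ++ M) ≡ (weight B ≡ᵇ a) ∧ blocksMatch α M
  blocksMatch-++ {m} a α B M lB = ≡.trans (cong and (map-allFin m _)) (cong₂ _∧_ (cong (_≡ᵇ a) first) (all-cong _ _ (allFin m) later))
    where
    first : countWhere (inBlock d 0) (B ++ M) ≡ weight B
    first = ≡.trans (countWhere-++ _ B M) (≡.trans (cong₂ _+_
              (countWhere-all _ B (λ x x<B → inBlock-first x (subst (x <_) lB x<B)))
              (countWhere-none _ M (λ x _ → ≡.trans (cong (λ k → inBlock d 0 (k + x)) lB) (inBlock-first-beyond x))))
            (ℕₚ.+-identityʳ (weight B)))
    later : ∀ i → (countWhere (inBlock d (suc (toℕ i))) (B ++ M) ≡ᵇ lookup α i) ≡ (countWhere (inBlock d (toℕ i)) M ≡ᵇ lookup α i)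
    later i = cong (_≡ᵇ lookup α i) (≡.trans (countWhere-++ _ B M) (cong₂ _+_
              (countWhere-none _ B (λ x x<B → inBlock-later (toℕ i) x (subst (x <_) lB x<B)))
              (countWhere-cong _ _ M (λ x _ → ≡.trans (cong (λ k → inBlock d (suc (toℕ i)) (k + x)) lB) (inBlock-shift (toℕ i) x)))))

  admissible-++ : ∀ {m} a (α : Vec ℕ m) B M → length B ≡ d → admissible (a Vec.∷ α) (B ++ M) ≡ (weight B ≡ᵇ a) ∧ admissible α M
  admissible-++ a α B M lB =
    ≡.trans (cong₂ (λ w b → (w ≡ᵇ a + sum α) ∧ b) (weight-++ B M) (blocksMatch-++ a α B M lB))
            (regroup (weight B) (weight M) (sum α) a (blocksMatch α M))
    where
    regroup : ∀ w w′ s a b → ((w + w′ ≡ᵇ a + s) ∧ ((w ≡ᵇ a) ∧ b)) ≡ (w ≡ᵇ a) ∧ ((w′ ≡ᵇ s) ∧ b)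
    regroup w w′ s a b with w ≡ᵇ a in eq
    ... | true  = cong (_∧ b) (≡.trans (cong (λ t → t + w′ ≡ᵇ a + s) (≡ᵇ⇒≡ w a eq)) (≡ᵇ-+ˡ a w′ s))
    ... | false = Boolₚ.∧-zeroʳ _

  -- on S_α the element sum is at least Σ_i binom(α_i, 2), so Sum* is a true difference
  minSum≤posSum : ∀ m (α : Vec ℕ m) M → length M ≡ m * d → admissible α M ≡ true → minSum α ≤ posSum M
  minSum≤posSum zero    Vec.[]       M _  _ = z≤n
  minSum≤posSum (suc m) (a Vec.∷ α) M lM h with splitPrefix d M (subst (d ≤_) (≡.sym lM) (ℕₚ.m≤m+n d (m * d)))
  ... | B , M′ , refl , lB = ℕₚ.≤-trans
          (ℕₚ.+-mono-≤ (subst (_≤ posSum B) (≡.trans (cong triangle (≡ᵇ⇒≡ (weight B) a (proj₁ parts))) (≡.sym (triangle-choose a))) (triangle-≤-posSum B))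
                       (minSum≤posSum m α M′ lM′ (proj₂ parts)))
          (subst (posSum B + posSum M′ ≤_) (≡.sym (posSum-++ B M′)) (ℕₚ.m≤m+n _ _))
    where
    parts = ∧-true (≡.trans (≡.sym (admissible-++ a α B M′ lB)) h)
    lM′ : length M′ ≡ m * d
    lM′ = ℕₚ.+-cancelˡ-≡ d _ _ (≡.trans (cong (_+ length M′) (≡.sym lB)) (≡.trans (≡.sym (Listₚ.length-++ B)) lM))

-- The cyclic sieving phenomenon for S_α at q = ω^j, block by block

module CSP {c ℓ} (R : CommutativeRing c ℓ) (dom : IsCharZeroDomain R)
           (e : ℕ) (ω : CommutativeRing.Carrier R) (prim : IsPrimitiveRoot R (suc e) ω) (j : ℕ) where
  open CommutativeRing R renaming (_+_ to _⊕_; _*_ to _⊗_; refl to ≈-refl; sym to ≈-sym; trans to ≈-trans)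
  open Sums R
  open Counting R
  open RotationOrder e j
  open Blocks e using (admissible; minSum; admissible-++; minSum≤posSum)
  open import Relation.Binary.Reasoning.Setoid setoid

  z : Carrier
  z = pow R ω j

  open QBinomial R z

  ω^-multiple : ∀ m → d ∣ m → pow R ω m ≈ 1#
  ω^-multiple m (divides q refl) = ≈-trans (pow-* ω q d) (≈-trans (pow-cong q (proj₁ prim)) (pow-1# q))

  ω^≈1⇒d∣ : ∀ m → pow R ω m ≈ 1# → d ∣ m
  ω^≈1⇒d∣ m ω^m≈1 = m%n≡0⇒n∣m m d (remainder-zero (m % d) refl (DivMod.m%n<n m d))
    where
    ω^rem≈1 : pow R ω (m % d) ≈ 1#
    ω^rem≈1 = begin
        pow R ω (m % d)                               ≈⟨ ≈-sym (≈-trans (*-congˡ (ω^-multiple _ (n∣m*n (m / d)))) (*-identityʳ _)) ⟩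
        pow R ω (m % d) ⊗ pow R ω ((m / d) * d)       ≈⟨ ≈-sym (pow-+ ω (m % d) _) ⟩
        pow R ω (m % d + (m / d) * d)                 ≡⟨ cong (pow R ω) (≡.sym (DivMod.m≡m%n+[m/n]*n m d)) ⟩
        pow R ω m                                     ≈⟨ ω^m≈1 ⟩
        1#                                            ∎
    remainder-zero : ∀ r → m % d ≡ r → r < d → m % d ≡ 0
    remainder-zero zero    eq _   = eq
    remainder-zero (suc r) eq r<d = ⊥-elim (proj₂ prim (suc r) (s≤s z≤n) r<d (≈-trans (reflexive (cong (pow R ω) (≡.sym eq))) ω^rem≈1))

  z^-as-ω : ∀ k → z^ k ≈ pow R ω (j * k)
  z^-as-ω k = ≈-trans (≈-sym (pow-* ω k j)) (reflexive (cong (pow R ω) (ℕₚ.*-comm k j)))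

  z^d* : ∀ k → z^ (d * k) ≈ 1#
  z^d* k = ≈-trans (z^-as-ω (d * k)) (ω^-multiple _ (∣n⇒∣m*n j (m∣m*n k)))

  z-order : z^ (suc o′) ≈ 1#
  z-order = ≈-trans (reflexive (cong z^ (≡.sym o≡1+o′))) (≈-trans (z^-as-ω o) (ω^-multiple _ d∣j*o))

  z-primitive : ∀ b → 0 < b → b < suc o′ → ¬ z^ b ≈ 1#
  z-primitive (suc b) _ b<o z^b≈1 =
    ℕₚ.<⇒≱ b<o (subst (_≤ suc b) o≡1+o′ (∣⇒≤ (d∣j*b⇒o∣b (suc b) (ω^≈1⇒d∣ _ (≈-trans (≈-sym (z^-as-ω (suc b))) z^b≈1)))))

  open QLucas R
  open AtRoot (proj₁ (proj₂ dom)) z o′ z-order z-primitive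

  blockGen blockFix : ℕ → Bits → Carrier
  blockGen a B = [ weight B ≡ᵇ a ]· z^ (posSum B ∸ triangle a)
  blockFix a B = [ (weight B ≡ᵇ a) ∧ fixedᵇ d j B ]· 1#

  gen fix : ∀ {m} → Vec ℕ m → Bits → Carrier
  gen α L = [ admissible α L ]· z^ (posSum L ∸ minSum α)
  fix α L = [ admissible α L ∧ fixedᵇ d j L ]· 1#

  -- fixed points of σ_d^j in one block: rotate^j-fixed, i.e. rotate^g-fixed strings
  fixed-count : ∀ a → ∑ (blockFix a) (strings d) ≈ scaledCount (suc o′) g a
  fixed-count a = begin
      ∑ (blockFix a) (strings d)
    ≈⟨ ∑-strings-cong d (λ L lL → reflexive (cong (λ t → [ (weight L ≡ᵇ a) ∧ t ]· 1#) (fixed-rotate-g L lL))) ⟩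
      ∑ (λ L → [ (weight L ≡ᵇ a) ∧ does (iter rotate g L ≟Bits L) ]· 1#) (strings d)
    ≡⟨ cong (λ n → ∑ (λ L → [ (weight L ≡ᵇ a) ∧ does (iter rotate g L ≟Bits L) ]· 1#) (strings n)) d≡1+o′*g ⟩
      ∑ (λ L → [ (weight L ≡ᵇ a) ∧ does (iter rotate g L ≟Bits L) ]· 1#) (strings (g + o′ * g))
    ≈⟨ periodic-count g o′ a ⟩
      scaledCount (suc o′) g a
    ∎
    where
    fixed-rotate-g : ∀ L → length L ≡ d → fixedᵇ d j L ≡ does (iter rotate g L ≟Bits L)
    fixed-rotate-g L lL = ≡.trans (fixedᵇ-rotate e j L lL)
      (does-⇔ (fixed-j⇔fixed-g rotate L (subst (λ k → iter rotate k L ≡ L) lL (rotate-period L)))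
              (iter rotate j L ≟Bits L) (iter rotate g L ≟Bits L))

  -- the CSP for a single block: multiplied by the unit z^binom(a,2), both
  -- sides become z^binom(a,2) · scaledCount (by q-Lucas and fixed-count)
  block-csp : ∀ a → ∑ (blockGen a) (strings d) ≈ ∑ (blockFix a) (strings d)
  block-csp a = ≈-trans (cancel-unit (z^ (triangle a)) (z^ (o′ * triangle a)) unit (begin
      ∑ (blockGen a) (strings d) ⊗ z^ (triangle a)
    ≈⟨ ≈-trans (∑-*ʳ _ _ (strings d)) (∑-cong (strings d) restore) ⟩
      qBinom d a
    ≡⟨ cong (λ n → qBinom n a) (≡.trans d≡1+o′*g (ℕₚ.*-comm (suc o′) g)) ⟩
      qBinom (g * suc o′) a
    ≈⟨ ≈-trans (q-lucas g a) (*-comm _ _) ⟩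
      scaledCount (suc o′) g a ⊗ z^ (triangle a)
    ∎)) (≈-sym (fixed-count a))
    where
    unit : z^ (triangle a) ⊗ z^ (o′ * triangle a) ≈ 1#
    unit = ≈-trans (≈-sym (pow-+ z (triangle a) (o′ * triangle a))) (z^o* (triangle a))
    restore : ∀ L → blockGen a L ⊗ z^ (triangle a) ≈ [ weight L ≡ᵇ a ]· z^ (posSum L)
    restore L with weight L ≡ᵇ a in eq
    ... | true  = ≈-trans (≈-sym (pow-+ z (posSum L ∸ triangle a) (triangle a))) (reflexive (cong z^ (ℕₚ.m∸n+n≡m
                    (subst (λ t → triangle t ≤ posSum L) (≡ᵇ⇒≡ (weight L) a eq) (triangle-≤-posSum L)))))
    ... | false = zeroˡ _

  fixedᵇ-[] : fixedᵇ d j [] ≡ true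
  fixedᵇ-[] = dec-true (iter (actBits d) j [] ≟Bits []) (iterate-[] j)
    where
    iterate-[] : ∀ j → iter (actBits d) j [] ≡ []
    iterate-[] zero    = refl
    iterate-[] (suc j) = cong (actBits d) (iterate-[] j)

  -- the statistic Sum* is additive over the first block and the rest,
  -- up to the shift d·#M of the rest, which z does not see
  gen-++ : ∀ {m} a (α : Vec ℕ m) B M → length B ≡ d → length M ≡ m * d → gen (a Vec.∷ α) (B ++ M) ≈ blockGen a B ⊗ gen α M
  gen-++ {m} a α B M lB lM = begin
      gen (a Vec.∷ α) (B ++ M)
    ≡⟨ cong (λ t → [ t ]· z^ (posSum (B ++ M) ∸ minSum (a Vec.∷ α))) (admissible-++ a α B M lB) ⟩
      [ (weight B ≡ᵇ a) ∧ admissible α M ]· z^ (posSum (B ++ M) ∸ minSum (a Vec.∷ α))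
    ≈⟨ [ (weight B ≡ᵇ a) ∧ admissible α M ]·-cong additive ⟩
      [ (weight B ≡ᵇ a) ∧ admissible α M ]· (z^ (posSum B ∸ triangle a) ⊗ z^ (posSum M ∸ minSum α))
    ≈⟨ [∧]·-* (weight B ≡ᵇ a) (admissible α M) _ _ ⟩
      blockGen a B ⊗ gen α M
    ∎
    where
    additive : (weight B ≡ᵇ a) ∧ admissible α M ≡ true
             → z^ (posSum (B ++ M) ∸ minSum (a Vec.∷ α)) ≈ z^ (posSum B ∸ triangle a) ⊗ z^ (posSum M ∸ minSum α)
    additive h = begin
        z^ (posSum (B ++ M) ∸ minSum (a Vec.∷ α))
      ≡⟨ cong z^ (≡.trans (cong₂ _∸_ (≡.trans (posSum-++ B M) (cong (λ k → posSum B + posSum M + k * weight M) lB))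
                                     (cong (_+ minSum α) (triangle-choose a)))
                          (∸-+-distrib (posSum B) (posSum M) (d * weight M) (triangle a) (minSum α) triangle≤ minSum≤)) ⟩
        z^ ((posSum B ∸ triangle a) + (posSum M ∸ minSum α) + d * weight M)
      ≈⟨ ≈-trans (pow-+ z (posSum B ∸ triangle a + (posSum M ∸ minSum α)) (d * weight M))
                 (≈-trans (*-congˡ (z^d* (weight M))) (*-identityʳ _)) ⟩
        z^ ((posSum B ∸ triangle a) + (posSum M ∸ minSum α))
      ≈⟨ pow-+ z (posSum B ∸ triangle a) (posSum M ∸ minSum α) ⟩
        z^ (posSum B ∸ triangle a) ⊗ z^ (posSum M ∸ minSum α)
      ∎
      where
      parts = ∧-true h
      triangle≤ : triangle a ≤ posSum B
      triangle≤ = subst (λ t → triangle t ≤ posSum B) (≡ᵇ⇒≡ (weight B) a (proj₁ parts)) (triangle-≤-posSum B)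
      minSum≤ : minSum α ≤ posSum M
      minSum≤ = minSum≤posSum m α M lM (proj₂ parts)

  fix-++ : ∀ {m} a (α : Vec ℕ m) B M → length B ≡ d → blockFix a B ⊗ fix α M ≈ fix (a Vec.∷ α) (B ++ M)
  fix-++ a α B M lB = begin
      blockFix a B ⊗ fix α M
    ≈⟨ ≈-sym ([∧]·-* ((weight B ≡ᵇ a) ∧ fixedᵇ d j B) (admissible α M ∧ fixedᵇ d j M) 1# 1#) ⟩
      [ ((weight B ≡ᵇ a) ∧ fixedᵇ d j B) ∧ (admissible α M ∧ fixedᵇ d j M) ]· (1# ⊗ 1#)
    ≈⟨ [ ((weight B ≡ᵇ a) ∧ fixedᵇ d j B) ∧ (admissible α M ∧ fixedᵇ d j M) ]·-cong (λ _ → *-identityʳ 1#) ⟩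
      [ ((weight B ≡ᵇ a) ∧ fixedᵇ d j B) ∧ (admissible α M ∧ fixedᵇ d j M) ]· 1#
    ≡⟨ cong ([_]· 1#) (≡.trans (∧-interchange (weight B ≡ᵇ a) (fixedᵇ d j B) (admissible α M) (fixedᵇ d j M))
                               (≡.sym (cong₂ _∧_ (admissible-++ a α B M lB) (fixedᵇ-++ e j B M lB)))) ⟩
      fix (a Vec.∷ α) (B ++ M)
    ∎

  -- both sides factor over the blocks, so the single-block CSP multiplies up to S_α
  all-blocks-csp : ∀ m (α : Vec ℕ m) → ∑ (gen α) (strings (m * d)) ≈ ∑ (fix α) (strings (m * d))
  all-blocks-csp zero    Vec.[]       = +-congʳ (reflexive (cong ([_]· 1#) (≡.sym fixedᵇ-[])))
  all-blocks-csp (suc m) (a Vec.∷ α) = begin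
      ∑ (gen (a Vec.∷ α)) (strings (d + m * d))
    ≈⟨ ∑-strings-split d (m * d) _ ⟩
      ∑ (λ B → ∑ (λ M → gen (a Vec.∷ α) (B ++ M)) (strings (m * d))) (strings d)
    ≈⟨ ∑-strings-cong d (λ B lB → ∑-strings-cong (m * d) (λ M lM → gen-++ a α B M lB lM)) ⟩
      ∑ (λ B → ∑ (λ M → blockGen a B ⊗ gen α M) (strings (m * d))) (strings d)
    ≈⟨ ∑-product _ _ (strings d) (strings (m * d)) ⟩
      ∑ (blockGen a) (strings d) ⊗ ∑ (gen α) (strings (m * d))
    ≈⟨ *-cong (block-csp a) (all-blocks-csp m α) ⟩
      ∑ (blockFix a) (strings d) ⊗ ∑ (fix α) (strings (m * d))
    ≈⟨ ≈-sym (∑-product _ _ (strings d) (strings (m * d))) ⟩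
      ∑ (λ B → ∑ (λ M → blockFix a B ⊗ fix α M) (strings (m * d))) (strings d)
    ≈⟨ ∑-strings-cong d (λ B lB → ∑-strings-cong (m * d) (λ M _ → fix-++ a α B M lB)) ⟩
      ∑ (λ B → ∑ (λ M → fix (a Vec.∷ α) (B ++ M)) (strings (m * d))) (strings d)
    ≈⟨ ≈-sym (∑-strings-split d (m * d) _) ⟩
      ∑ (fix (a Vec.∷ α)) (strings (d + m * d))
    ∎

  module _ (m : ℕ) (α : Vec ℕ m) where
    private
      n = m * d

    inSalpha : Subset n → Bool
    inSalpha A = (∣ A ∣ ≡ᵇ sum α) ∧ all (λ i → blockCount d A (toℕ i) ≡ᵇ lookup α i) (allFin m)

    inSalpha-toList : ∀ A → inSalpha A ≡ admissible α (toList A)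
    inSalpha-toList A = cong₂ _∧_ (cong (_≡ᵇ sum α) (weight-toList n A))
      (all-cong _ _ (allFin m) (λ i → cong (_≡ᵇ lookup α i) (countWhere-toList n A (inBlock d (toℕ i)))))

    fixed-toList : ∀ A → does (Vecₚ.≡-dec Boolₚ._≟_ (actPow d j A) A) ≡ fixedᵇ d j (toList A)
    fixed-toList A = does-⇔
      (mk⇔ (λ h → ≡.trans (≡.sym (actPow-toList d n j A)) (cong toList h))
           (λ h → ≡.trans (≡.sym (Vecₚ.cast-is-id refl (actPow d j A))) (Vecₚ.toList-injective refl (actPow d j A) A (≡.trans (actPow-toList d n j A) h))))
      (Vecₚ.≡-dec Boolₚ._≟_ (actPow d j A) A) (iter (actBits d) j (toList A) ≟Bits toList A)

    ∑-subsets : ∀ (f : Bits → Carrier) → ∑ (f ∘ toList) (allSubsets n) ≡ ∑ f (strings n)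
    ∑-subsets f = ≡.trans (≡.sym (∑-map f toList (allSubsets n))) (cong (∑ f) (strings-allSubsets n))

    csp : genEval R (Salpha n d m α (sum α)) (sumStar α) z ≈ natR R (fixCount n d m α (sum α) j)
    csp = begin
        genEval R (Salpha n d m α (sum α)) (sumStar α) z
      ≈⟨ genEval-filterᵇ inSalpha (sumStar α) z (allSubsets n) ⟩
        ∑ (λ A → [ inSalpha A ]· z^ (sumStar α A)) (allSubsets n)
      ≈⟨ ∑-cong (allSubsets n) (λ A → reflexive (cong₂ (λ b s → [ b ]· z^ s) (inSalpha-toList A) (cong (_∸ minSum α) (elemSum-posSum n A)))) ⟩
        ∑ (gen α ∘ toList) (allSubsets n)
      ≡⟨ ∑-subsets (gen α) ⟩
        ∑ (gen α) (strings n)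
      ≈⟨ all-blocks-csp m α ⟩
        ∑ (fix α) (strings n)
      ≡⟨ ≡.sym (∑-subsets (fix α)) ⟩
        ∑ (fix α ∘ toList) (allSubsets n)
      ≈⟨ ∑-cong (allSubsets n) (λ A → reflexive (cong ([_]· 1#) (≡.sym (cong₂ _∧_ (inSalpha-toList A) (fixed-toList A))))) ⟩
        ∑ (λ A → [ inSalpha A ∧ does (Vecₚ.≡-dec Boolₚ._≟_ (actPow d j A) A) ]· 1#) (allSubsets n)
      ≈⟨ ≈-sym (natR-count inSalpha _ (λ A → Vecₚ.≡-dec Boolₚ._≟_ (actPow d j A) A) (allSubsets n)) ⟩
        natR R (fixCount n d m α (sum α) j)
      ∎

proposition7p5 : ∀ {c ℓ} (n k d : ℕ) → 1 ≤ n → (d∣n : d ∣ n)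
    → (α : Vec ℕ (_∣_.quotient d∣n)) → sum α ≡ k
    → (R : CommutativeRing c ℓ) → IsCharZeroDomain R
    → (ω : CommutativeRing.Carrier R) → IsPrimitiveRoot R d ω
    → (j : ℕ)
    → CommutativeRing._≈_ R
        (genEval R (Salpha n d (_∣_.quotient d∣n) α k) (sumStar α) (pow R ω j))
        (natR R (fixCount n d (_∣_.quotient d∣n) α k j))
proposition7p5 .(m * zero)  k       zero    1≤n (divides m refl) α _    R dom ω prim j =
  ⊥-elim (ℕₚ.<⇒≱ 1≤n (ℕₚ.≤-reflexive (ℕₚ.*-zeroʳ m)))
proposition7p5 .(m * suc e) .(sum α) (suc e) 1≤n (divides m refl) α refl R dom ω prim j =
  CSP.csp R dom e ω prim j m α
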